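{- For $z,z'\in\mathfrak{z}$ and $w\in\mathfrak{A}^1$ we have $$\exp(\delta_z)(z')=\big(\exp_\circ(z)\circ z'\big)\exp_*(z),\qquad \exp(\delta_z)(w)=\big(\exp_*(z)\big)^{ -1}\big(\exp_*(z)*w\big).$$
   Context: Fix an integer $N\ge1$; indices read modulo $N$. Let $\mathfrak{A}=\mathbb{Q}\langle a,b_0,\dots,b_{N-1}\rangle$ (concatenation as juxtaposition, unit $\mathbf{1}=1$), graded by weight = number of letters; $y_{s,i}=a^{s-1}b_i$; $\mathfrak{A}^1$ is the span of words not ending in $a$; $\mathfrak{z}$ is the $\mathbb{Q}$-span of the $y_{s,0}$ ($s\ge1$). For an integer $j$, $\tau_j(y_{s_1,i_1}\cdots y_{s_n,i_n})=y_{s_1,i_1+j}\cdots y_{s_n,i_n+j}$, $\tau_j(\mathbf{1})=\mathbf{1}$. Stuffle $*$ on $\mathfrak{A}^1$: bilinear, $\mathbf{1}*w=w*\mathbf{1}=w$, $y_{s,j}\omega_1*y_{t,k}\omega_2=y_{s,j}\tau_j(\tau_{ -j}(\omega_1)*y_{t,k}\omega_2)+y_{t,k}\tau_k(y_{s,j}\omega_1*\tau_{ -k}(\omega_2))+y_{s+t,j+k}\tau_{j+k}(\tau_{ -j}(\omega_1)*\tau_{ -k}(\omega_2))$. For $z\in\mathfrak{z}$, $\delta_z(w)=z*w-zw$ (a derivation of $\mathfrak{A}^1$) and $\exp(\delta_z)=\sum_{n\ge0}\delta_z^n/n!$. On $\mathfrak{z}$, $z\circ z'=z*z'-zz'-z'z$;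 $\exp_\circ(z)=1+\sum_{n\ge1}z^{\circ n}/n!$, with the convention $1\circ z'=z'$; $\exp_*(z)=\sum_{n\ge0}z^{*n}/n!$; $(\exp_*(z))^{ -1}$ is the inverse for concatenation. All infinite sums are taken in the completion of $\mathfrak{A}^1$ with respect to weight. -}

module Defs where

open import Data.Nat as ℕ using (ℕ; zero; suc; _∸_; _!)
open import Data.Nat.Properties using (_!≢0)
open import Data.Nat.DivMod using (_mod_)
open import Data.Fin as Fin using (Fin; toℕ)
open import Data.List using (List; []; _∷_; _++_; map; concatMap; length; foldr)
open import Data.Product using (_×_; _,_; proj₁; proj₂)
open import Data.Integer as ℤ using (+_)
open import Data.Rational as ℚ using (ℚ; 0ℚ; 1ℚ; _*_; _+_; -_)
open import Relation.Nullary using (yes; no; Dec)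
open import Relation.Binary.PropositionalEquality using (_≡_; refl; cong₂)
open import Data.Fin.Properties using () renaming (_≟_ to _≟ᶠ_)
open import Data.Nat.Properties using () renaming (_≟_ to _≟ℕ_)
import Data.List.Properties as LP

invFact : ℕ → ℚ
invFact k = (+ 1) ℚ./ (k !)
  where instance _ = k !≢0

-- Everything is parametrised by n, with N = n + 1 ≥ 1 the modulus of the indices.
module Stuffle (n : ℕ) where

  N : ℕ
  N = suc n

  -- The letter  y e i  stands for  y_{e+1,i} = a^e b_i  (so s = e + 1 ≥ 1).
  -- Words of 𝔄^1 (words not ending in a) are exactly the concatenations of such letters.
  record Y : Set where
    constructor y
    field
      e : ℕ
      i : Fin N

  Word : Set
  Word = List Y

  _≟Y_ : (u v : Y) → Dec (u ≡ v)
  y e i ≟Y y e' i' with e ≟ℕ e' | i ≟ᶠ i'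
  ... | yes refl | yes refl = yes refl
  ... | no ne    | _        = no λ { refl → ne refl }
  ... | yes _    | no ne    = no λ { refl → ne refl }

  _≟W_ : (u v : Word) → Dec (u ≡ v)
  _≟W_ = LP.≡-dec _≟Y_

  wt : Word → ℕ
  wt [] = 0
  wt (y e _ ∷ u) = suc e ℕ.+ wt u

  shiftIdx : ℕ → Fin N → Fin N
  shiftIdx j i = (toℕ i ℕ.+ j) mod N

  negIdx : Fin N → ℕ
  negIdx j = N ∸ toℕ j

  τ : ℕ → Word → Word
  τ j = map (λ { (y e i) → y e (shiftIdx j i) })

  -- Elements of 𝔄^1 : finite formal ℚ-linear combinations of words
  Poly : Set
  Poly = List (ℚ × Word)

  coeff : Poly → Word → ℚ
  coeff [] u = 0ℚ
  coeff ((c , v) ∷ p) u with v ≟W u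
  ... | yes _ = c + coeff p u
  ... | no _  = coeff p u

  𝟙 : Poly
  𝟙 = (1ℚ , []) ∷ []

  word : Word → Poly
  word w = (1ℚ , w) ∷ []

  0P : Poly
  0P = []

  infixl 6 _⊕_ _⊖_
  _⊕_ : Poly → Poly → Poly
  _⊕_ = _++_

  scale : ℚ → Poly → Poly
  scale q = map (λ { (c , w) → (q * c , w) })

  _⊖_ : Poly → Poly → Poly
  p ⊖ q = p ⊕ scale (- 1ℚ) q

  τP : ℕ → Poly → Poly
  τP j = map (λ { (c , w) → (c , τ j w) })

  prefix : Y → Poly → Poly
  prefix x = map (λ { (c , w) → (c , x ∷ w) })

  infixl 7 _·_
  _·_ : Poly → Poly → Poly
  p · q = concatMap (λ { (c , u) → map (λ { (d , v) → (c * d , u ++ v) }) q }) p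

  -- stuffle of two words, by the recursive definition; the first argument is
  -- fuel (length u + length v suffices, since τ preserves length)
  stf : ℕ → Word → Word → Poly
  stf _ [] v = word v
  stf _ (x ∷ u) [] = word (x ∷ u)
  stf zero (_ ∷ _) (_ ∷ _) = 0P
  stf (suc f) (y s j ∷ ω₁) (y t k ∷ ω₂) =
      prefix (y s j) (τP (toℕ j) (stf f (τ (negIdx j) ω₁) (y t k ∷ ω₂)))
    ⊕ prefix (y t k) (τP (toℕ k) (stf f (y s j ∷ ω₁) (τ (negIdx k) ω₂)))
    ⊕ prefix (y (suc (s ℕ.+ t)) (shiftIdx (toℕ k) j))
             (τP (toℕ j ℕ.+ toℕ k) (stf f (τ (negIdx j) ω₁) (τ (negIdx k) ω₂)))

  wstuffle : Word → Word → Poly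
  wstuffle u v = stf (length u ℕ.+ length v) u v

  infixl 7 _⋆_
  _⋆_ : Poly → Poly → Poly
  p ⋆ q = concatMap (λ { (c , u) → concatMap (λ { (d , v) → scale (c * d) (wstuffle u v) }) q }) p

  -- Elements of 𝔷 : finite ℚ-combinations of y_{e+1,0}; (q , e) means q · y_{e+1,0}
  Zelt : Set
  Zelt = List (ℚ × ℕ)

  toP : Zelt → Poly
  toP = map (λ { (q , e) → (q , y e Fin.zero ∷ []) })

  δ : Poly → Poly → Poly
  δ z w = (z ⋆ w) ⊖ (z · w)

  δ^ : ℕ → Poly → Poly → Poly
  δ^ zero z w = w
  δ^ (suc k) z w = δ z (δ^ k z w)

  _∘_ : Poly → Poly → Poly
  z ∘ z' = (z ⋆ z') ⊖ (z · z') ⊖ (z' · z)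

  Σ≤ : ℕ → (ℕ → Poly) → Poly
  Σ≤ zero f = f 0
  Σ≤ (suc m) f = Σ≤ m f ⊕ f (suc m)

  starPow : Poly → ℕ → Poly
  starPow z zero = 𝟙
  starPow z (suc k) = z ⋆ starPow z k

  -- z^{∘ (k+1)}
  circPowS : Poly → ℕ → Poly
  circPowS z zero = z
  circPowS z (suc k) = z ∘ circPowS z k

  catPow : Poly → ℕ → Poly
  catPow p zero = 𝟙
  catPow p (suc k) = p · catPow p k

  -- Truncations at level m of the infinite sums.  Every omitted term has
  -- all its words of weight > m, so the coefficient of a word u in the
  -- (completed) infinite sum equals its coefficient in the level-(wt u)
  -- truncation.

  expδ : ℕ → Poly → Poly → Poly
  expδ m z w = Σ≤ m (λ k → scale (invFact k) (δ^ k z w))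

  exp⋆ : ℕ → Poly → Poly
  exp⋆ m z = Σ≤ m (λ k → scale (invFact k) (starPow z k))

  -- exp_∘(z) ∘ z' = 1 ∘ z' + Σ_{k ≥ 1} (z^{∘k} ∘ z')/k!  with  1 ∘ z' = z'
  exp∘∘ : ℕ → Poly → Poly → Poly
  exp∘∘ m z z' = z' ⊕ Σ≤ m (λ k → scale (invFact (suc k)) (circPowS z k ∘ z'))

  -- concatenation inverse of E (E with constant term 1): Σ_{k} (1 - E)^k
  invCat : ℕ → Poly → Poly
  invCat m E = Σ≤ m (λ k → catPow (𝟙 ⊖ E) k)

  -- The series, as coefficient functions on words (elements of the completion)

  Series : Set
  Series = Word → ℚ

  expδS : Zelt → Poly → Series
  expδS z w u = coeff (expδ (wt u) (toP z) w) u

  rhs₁ : Zelt → Zelt → Series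
  rhs₁ z z' u = coeff (exp∘∘ (wt u) (toP z) (toP z') · exp⋆ (wt u) (toP z)) u

  rhs₂ : Zelt → Poly → Series
  rhs₂ z w u = coeff (invCat (wt u) (exp⋆ (wt u) (toP z)) · (exp⋆ (wt u) (toP z) ⋆ w)) u

module Submission where

-- In relative coordinates, where each index is recorded as an offset from the index of the
-- preceding letter, the twisted stuffle becomes the ordinary quasi-shuffle, in which merged
-- letters add their exponents and their offsets; elements of 𝔷, having all indices 0, are
-- unaffected, and so is left multiplication by them.  For a combination z of letters the
-- quasi-shuffle satisfies the product rules
--   z * (p q) = (z * p) q + p δ_z(q)   and   δ_z(c q) = (z ∘ c) q + c (z * q),
-- so δ_z, resp. z * _, acts on the products of the terms z^{∘a}∘z'/a! and z^{*b}/b!, resp.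
-- z^{*a}/a! and δ_z^b(w)/b!, by a Leibniz rule.  Hence δ_z^k(z')/k! and z^{*k} * w/k! are
-- the degree-k parts of the products of the corresponding exponential series, which are
-- the two identities (the second after multiplying by (exp_*(z))^{-1}).  Coefficients of a
-- word of weight m only involve the terms of total degree at most m, so all series may be
-- truncated at m.

open import Defs
open import Algebra.Bundles using (CommutativeMonoid)
import Algebra.Solver.CommutativeMonoid as CommutativeMonoidSolver
open import Data.Empty using (⊥-elim)
open import Data.Unit using (⊤)
open import Data.Fin as Fin using (Fin; toℕ)
import Data.Fin.Properties as FinP
import Data.Integer as ℤ
import Data.Integer.Properties as ℤP
open import Data.List using ([]; _∷_; _++_; map; concatMap; length)
import Data.List.Properties as ListP
open import Data.List.Relation.Unary.All as All using (All; []; _∷_)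
import Data.List.Relation.Unary.All.Properties as AllP
open import Data.Nat as ℕ using (ℕ; zero; suc; _%_; _≤_; z≤n; s≤s; _!)
open import Data.Nat.DivMod using (_mod_; %-distribˡ-+; m<n⇒m%n≡m; [m+n]%n≡m%n; m%n%n≡m%n)
import Data.Nat.Properties as ℕP
open import Data.Nat.Tactic.RingSolver using (solve-∀)
open import Data.Product using (∃; _×_; _,_; proj₂)
open import Data.Rational as ℚ using (ℚ; 0ℚ; 1ℚ; _*_; _+_; -_; toℚᵘ)
import Data.Rational.Properties as ℚP
open import Data.Rational.Solver using (module +-*-Solver)
import Data.Rational.Unnormalised as ℚᵘ
import Data.Rational.Unnormalised.Properties as ℚᵘP
open import Relation.Binary.Bundles using (Setoid)
import Relation.Binary.Reasoning.Setoid as SetoidReasoning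
open import Relation.Binary.PropositionalEquality
open import Relation.Nullary using (yes; no; ¬_)

open +-*-Solver

fromℕ : ℕ → ℚ
fromℕ zero = 0ℚ
fromℕ (suc m) = 1ℚ + fromℕ m

fromℕ-+ : ∀ a b → fromℕ (a ℕ.+ b) ≡ fromℕ a + fromℕ b
fromℕ-+ zero b = sym (ℚP.+-identityˡ (fromℕ b))
fromℕ-+ (suc a) b = trans (cong (1ℚ +_) (fromℕ-+ a b)) (sym (ℚP.+-assoc 1ℚ (fromℕ a) (fromℕ b)))

fromℕ-* : ∀ a b → fromℕ (a ℕ.* b) ≡ fromℕ a * fromℕ b
fromℕ-* zero b = sym (ℚP.*-zeroˡ (fromℕ b))
fromℕ-* (suc a) b = trans (fromℕ-+ b (a ℕ.* b)) (trans (cong (fromℕ b +_) (fromℕ-* a b))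
  (solve 2 (λ x y → y :+ x :* y := (con 1ℚ :+ x) :* y) refl (fromℕ a) (fromℕ b)))

toℚᵘ-fromℕ : ∀ m → toℚᵘ (fromℕ m) ℚᵘ.≃ ℚᵘ.mkℚᵘ (ℤ.+ m) 0
toℚᵘ-fromℕ zero = ℚᵘ.*≡* refl
toℚᵘ-fromℕ (suc m) = ℚᵘP.≃-trans (ℚP.toℚᵘ-homo-+ 1ℚ (fromℕ m))
  (ℚᵘP.≃-trans (ℚᵘP.+-congʳ (ℚᵘ.mkℚᵘ (ℤ.+ 1) 0) (toℚᵘ-fromℕ m)) (ℚᵘ.*≡* (trans (ℤP.*-identityʳ _)
    (trans (cong (ℤ._+_ (ℤ.+ 1)) (ℤP.*-identityʳ (ℤ.+ m))) (sym (ℤP.*-identityʳ (ℤ.+ suc m)))))))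

invFact-*-fromℕ-! : ∀ k → invFact k * fromℕ (k !) ≡ 1ℚ
invFact-*-fromℕ-! k = inverse (k !) {{k ℕP.!≢0}}
  where
    inverse : ∀ d .{{_ : ℕ.NonZero d}} → ((ℤ.+ 1) ℚ./ d) * fromℕ d ≡ 1ℚ
    inverse (suc d) = ℚP.toℚᵘ-injective (ℚᵘP.≃-trans (ℚP.toℚᵘ-homo-* ((ℤ.+ 1) ℚ./ suc d) (fromℕ (suc d)))
      (ℚᵘP.≃-trans (ℚᵘP.*-cong (ℚP.toℚᵘ-fromℚᵘ (ℚᵘ.mkℚᵘ (ℤ.+ 1) d)) (toℚᵘ-fromℕ (suc d)))
        (ℚᵘ.*≡* (trans (ℤP.*-identityʳ _) (trans (ℤP.*-identityˡ (ℤ.+ suc d))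
          (sym (trans (ℤP.*-identityˡ _) (cong (λ m → ℤ.+ m) (ℕP.*-identityʳ (suc d))))))))))

fromℕ-suc-*-invFact-suc : ∀ k → fromℕ (suc k) * invFact (suc k) ≡ invFact k
fromℕ-suc-*-invFact-suc k = begin
  s * i                ≡⟨ sym (ℚP.*-identityʳ (s * i)) ⟩
  s * i * 1ℚ           ≡⟨ cong (s * i *_) (sym (invFact-*-fromℕ-! k)) ⟩
  s * i * (j * f)      ≡⟨ solve 4 (λ s i j f → s :* i :* (j :* f) := i :* (s :* f) :* j) refl s i j f ⟩
  i * (s * f) * j      ≡⟨ cong (λ r → i * r * j) (sym (fromℕ-* (suc k) (k !))) ⟩
  i * fromℕ (suc k !) * j  ≡⟨ cong (_* j) (invFact-*-fromℕ-! (suc k)) ⟩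
  1ℚ * j               ≡⟨ ℚP.*-identityˡ j ⟩
  j                    ∎
  where
    open ≡-Reasoning
    s = fromℕ (suc k)
    i = invFact (suc k)
    j = invFact k
    f = fromℕ (k !)

module _ (n : ℕ) where
  open Stuffle n

  infix 4 _≈_
  record _≈_ (p q : Poly) : Set where
    constructor coeffwise
    field coeff-≡ : ∀ u → coeff p u ≡ coeff q u
  open _≈_

  ≈-refl : ∀ {p} → p ≈ p
  ≈-refl = coeffwise λ _ → refl

  ≈-sym : ∀ {p q} → p ≈ q → q ≈ p
  ≈-sym e = coeffwise λ u → sym (coeff-≡ e u)

  ≈-trans : ∀ {p q r} → p ≈ q → q ≈ r → p ≈ r
  ≈-trans e f = coeffwise λ u → trans (coeff-≡ e u) (coeff-≡ f u)

  ≡⇒≈ : ∀ {p q} → p ≡ q → p ≈ q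
  ≡⇒≈ refl = ≈-refl

  ≈-setoid : Setoid _ _
  ≈-setoid = record
    { Carrier = Poly ; _≈_ = _≈_ ; isEquivalence = record { refl = ≈-refl ; sym = ≈-sym ; trans = ≈-trans } }

  module ≈-Reasoning = SetoidReasoning ≈-setoid

  coeff-⊕ : ∀ p q u → coeff (p ⊕ q) u ≡ coeff p u + coeff q u
  coeff-⊕ [] q u = sym (ℚP.+-identityˡ _)
  coeff-⊕ ((c , v) ∷ p) q u with v ≟W u
  ... | yes _ = trans (cong (c +_) (coeff-⊕ p q u)) (sym (ℚP.+-assoc c _ _))
  ... | no _ = coeff-⊕ p q u

  coeff-scale : ∀ a p u → coeff (scale a p) u ≡ a * coeff p u
  coeff-scale a [] u = sym (ℚP.*-zeroʳ a)
  coeff-scale a ((c , v) ∷ p) u with v ≟W u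
  ... | yes _ = trans (cong (a * c +_) (coeff-scale a p u)) (sym (ℚP.*-distribˡ-+ a c _))
  ... | no _ = coeff-scale a p u

  coeff-⊖ : ∀ p q u → coeff (p ⊖ q) u ≡ coeff p u + - 1ℚ * coeff q u
  coeff-⊖ p q u = trans (coeff-⊕ p _ u) (cong (coeff p u +_) (coeff-scale (- 1ℚ) q u))

  ⊕-cong : ∀ {p p′ q q′} → p ≈ p′ → q ≈ q′ → p ⊕ q ≈ p′ ⊕ q′
  ⊕-cong {p} {p′} {q} {q′} e f = coeffwise λ u →
    trans (coeff-⊕ p q u) (trans (cong₂ _+_ (coeff-≡ e u) (coeff-≡ f u)) (sym (coeff-⊕ p′ q′ u)))

  ⊕-congˡ : ∀ p {q q′} → q ≈ q′ → p ⊕ q ≈ p ⊕ q′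
  ⊕-congˡ p = ⊕-cong ≈-refl

  ⊕-congʳ : ∀ q {p p′} → p ≈ p′ → p ⊕ q ≈ p′ ⊕ q
  ⊕-congʳ q e = ⊕-cong e ≈-refl

  ⊕-comm : ∀ p q → p ⊕ q ≈ q ⊕ p
  ⊕-comm p q = coeffwise λ u → trans (coeff-⊕ p q u) (trans (ℚP.+-comm (coeff p u) _) (sym (coeff-⊕ q p u)))

  ⊕-commutativeMonoid : CommutativeMonoid _ _
  ⊕-commutativeMonoid = record
    { Carrier = Poly ; _≈_ = _≈_ ; _∙_ = _⊕_ ; ε = 0P
    ; isCommutativeMonoid = record
      { isMonoid = record
        { isSemigroup = record
          { isMagma = record { isEquivalence = Setoid.isEquivalence ≈-setoid ; ∙-cong = ⊕-cong }
          ; assoc = λ p q r → ≡⇒≈ (ListP.++-assoc p q r) }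
        ; identity = (λ _ → ≈-refl) , (λ p → ≡⇒≈ (ListP.++-identityʳ p)) }
      ; comm = ⊕-comm } }

  open CommutativeMonoidSolver ⊕-commutativeMonoid using (_⊜_) renaming (solve to ⊕-solve; _⊕_ to infixl 6 _⊞_)

  ⊕-interchange : ∀ a b c d → (a ⊕ b) ⊕ (c ⊕ d) ≈ (a ⊕ c) ⊕ (b ⊕ d)
  ⊕-interchange = ⊕-solve 4 (λ a b c d → (a ⊞ b) ⊞ (c ⊞ d) ⊜ (a ⊞ c) ⊞ (b ⊞ d)) ≈-refl

  scale-cong : ∀ a {p q} → p ≈ q → scale a p ≈ scale a q
  scale-cong a {p} {q} e = coeffwise λ u →
    trans (coeff-scale a p u) (trans (cong (a *_) (coeff-≡ e u)) (sym (coeff-scale a q u)))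

  scale-⊕ : ∀ a p q → scale a (p ⊕ q) ≡ scale a p ⊕ scale a q
  scale-⊕ a = ListP.map-++ _

  scale-* : ∀ a b p → scale a (scale b p) ≈ scale (a * b) p
  scale-* a b p = coeffwise λ u → trans (coeff-scale a (scale b p) u)
    (trans (cong (a *_) (coeff-scale b p u)) (trans (sym (ℚP.*-assoc a b _)) (sym (coeff-scale (a * b) p u))))

  scale-1 : ∀ p → scale 1ℚ p ≈ p
  scale-1 p = coeffwise λ u → trans (coeff-scale 1ℚ p u) (ℚP.*-identityˡ _)

  scale-0 : ∀ p → scale 0ℚ p ≈ 0P
  scale-0 p = coeffwise λ u → trans (coeff-scale 0ℚ p u) (ℚP.*-zeroˡ (coeff p u))

  scale-+ : ∀ a b p → scale (a + b) p ≈ scale a p ⊕ scale b p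
  scale-+ a b p = coeffwise λ u → trans (coeff-scale (a + b) p u) (trans (ℚP.*-distribʳ-+ (coeff p u) a b)
    (sym (trans (coeff-⊕ (scale a p) _ u) (cong₂ _+_ (coeff-scale a p u) (coeff-scale b p u)))))

  ⊖-cancel : ∀ p → p ⊖ p ≈ 0P
  ⊖-cancel p = coeffwise λ u → trans (coeff-⊖ p p u) (solve 1 (λ a → a :+ con (- 1ℚ) :* a := con 0ℚ) refl (coeff p u))

  ⊖-⊕-cancel : ∀ p q → (p ⊖ q) ⊕ q ≈ p
  ⊖-⊕-cancel p q = coeffwise λ u → trans (coeff-⊕ (p ⊖ q) q u) (trans (cong (_+ coeff q u) (coeff-⊖ p q u))
    (solve 2 (λ x y → x :+ con (- 1ℚ) :* y :+ y := x) refl (coeff p u) (coeff q u)))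

  ⊖-⊕-⊖ : ∀ p q r → (p ⊖ q) ⊕ (q ⊖ r) ≈ p ⊖ r
  ⊖-⊕-⊖ p q r = coeffwise λ u → begin
      coeff ((p ⊖ q) ⊕ (q ⊖ r)) u
    ≡⟨ trans (coeff-⊕ (p ⊖ q) (q ⊖ r) u) (cong₂ _+_ (coeff-⊖ p q u) (coeff-⊖ q r u)) ⟩
      coeff p u + - 1ℚ * coeff q u + (coeff q u + - 1ℚ * coeff r u)
    ≡⟨ solve 3 (λ a b c → a :+ con (- 1ℚ) :* b :+ (b :+ con (- 1ℚ) :* c) := a :+ con (- 1ℚ) :* c) refl
         (coeff p u) (coeff q u) (coeff r u) ⟩
      coeff p u + - 1ℚ * coeff r u
    ≡⟨ coeff-⊖ p r u ⟨
      coeff (p ⊖ r) u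
    ∎
    where open ≡-Reasoning

  ⊖-⊖ : ∀ p q → p ⊖ (p ⊖ q) ≈ q
  ⊖-⊖ p q = coeffwise λ u → begin
      coeff (p ⊖ (p ⊖ q)) u
    ≡⟨ trans (coeff-⊖ p (p ⊖ q) u) (cong (λ c → coeff p u + - 1ℚ * c) (coeff-⊖ p q u)) ⟩
      coeff p u + - 1ℚ * (coeff p u + - 1ℚ * coeff q u)
    ≡⟨ solve 2 (λ a b → a :+ con (- 1ℚ) :* (a :+ con (- 1ℚ) :* b) := b) refl (coeff p u) (coeff q u) ⟩
      coeff q u
    ∎
    where open ≡-Reasoning

  ⊖-⊕ : ∀ p q → p ⊖ (p ⊕ q) ≈ scale (- 1ℚ) q
  ⊖-⊕ p q = coeffwise λ u → begin
      coeff (p ⊖ (p ⊕ q)) u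
    ≡⟨ trans (coeff-⊖ p (p ⊕ q) u) (cong (λ c → coeff p u + - 1ℚ * c) (coeff-⊕ p q u)) ⟩
      coeff p u + - 1ℚ * (coeff p u + coeff q u)
    ≡⟨ solve 2 (λ a b → a :+ con (- 1ℚ) :* (a :+ b) := con (- 1ℚ) :* b) refl (coeff p u) (coeff q u) ⟩
      - 1ℚ * coeff q u
    ≡⟨ coeff-scale (- 1ℚ) q u ⟨
      coeff (scale (- 1ℚ) q) u
    ∎
    where open ≡-Reasoning

  singleton≈scale-word : ∀ c v → (c , v) ∷ [] ≈ scale c (word v)
  singleton≈scale-word c v = coeffwise coeff-singleton
    where
      coeff-singleton : ∀ u → coeff ((c , v) ∷ []) u ≡ coeff (scale c (word v)) u
      coeff-singleton u with v ≟W u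
      ... | yes _ = cong (_+ 0ℚ) (sym (ℚP.*-identityʳ c))
      ... | no _ = refl

  sumWith : (Word → ℚ) → Poly → ℚ
  sumWith g [] = 0ℚ
  sumWith g ((c , v) ∷ p) = c * g v + sumWith g p

  remove : Word → Poly → Poly
  remove v [] = []
  remove v ((c , w) ∷ p) with w ≟W v
  ... | yes _ = remove v p
  ... | no _ = (c , w) ∷ remove v p

  sumWith-remove : ∀ g v p → sumWith g p ≡ coeff p v * g v + sumWith g (remove v p)
  sumWith-remove g v [] = sym (trans (ℚP.+-identityʳ _) (ℚP.*-zeroˡ (g v)))
  sumWith-remove g v ((c , w) ∷ p) with w ≟W v
  ... | yes refl = trans (cong (c * g w +_) (sumWith-remove g w p))
         (solve 4 (λ c x a b → c :* x :+ (a :* x :+ b) := (c :+ a) :* x :+ b) refl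
           c (g w) (coeff p w) (sumWith g (remove w p)))
  ... | no _ = trans (cong (c * g w +_) (sumWith-remove g v p))
         (solve 3 (λ a b c → a :+ (b :+ c) := b :+ (a :+ c)) refl (c * g w) (coeff p v * g v) (sumWith g (remove v p)))

  coeff-remove-self : ∀ v p → coeff (remove v p) v ≡ 0ℚ
  coeff-remove-self v [] = refl
  coeff-remove-self v ((c , w) ∷ p) with w ≟W v
  ... | yes _ = coeff-remove-self v p
  ... | no w≢v with w ≟W v
  ...   | yes w≡v = ⊥-elim (w≢v w≡v)
  ...   | no _ = coeff-remove-self v p

  coeff-remove-other : ∀ v p u → ¬ v ≡ u → coeff (remove v p) u ≡ coeff p u
  coeff-remove-other v [] u v≢u = refl
  coeff-remove-other v ((c , w) ∷ p) u v≢u with w ≟W v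
  ... | yes refl with w ≟W u
  ...   | yes w≡u = ⊥-elim (v≢u w≡u)
  ...   | no _ = coeff-remove-other v p u v≢u
  coeff-remove-other v ((c , w) ∷ p) u v≢u | no _ with w ≟W u
  ...   | yes _ = cong (c +_) (coeff-remove-other v p u v≢u)
  ...   | no _ = coeff-remove-other v p u v≢u

  remove-cong : ∀ v {p q} → p ≈ q → remove v p ≈ remove v q
  remove-cong v {p} {q} e = coeffwise coeff-remove
    where
      coeff-remove : ∀ u → coeff (remove v p) u ≡ coeff (remove v q) u
      coeff-remove u with v ≟W u
      ... | yes refl = trans (coeff-remove-self v p) (sym (coeff-remove-self v q))
      ... | no v≢u = trans (coeff-remove-other v p u v≢u) (trans (coeff-≡ e u) (sym (coeff-remove-other v q u v≢u)))

  length-remove : ∀ v p → length (remove v p) ≤ length p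
  length-remove v [] = z≤n
  length-remove v ((c , w) ∷ p) with w ≟W v
  ... | yes _ = ℕP.m≤n⇒m≤1+n (length-remove v p)
  ... | no _ = s≤s (length-remove v p)

  length-remove-head : ∀ c v p → length (remove v ((c , v) ∷ p)) ≤ length p
  length-remove-head c v p with v ≟W v
  ... | yes _ = length-remove v p
  ... | no v≢v = ⊥-elim (v≢v refl)

  -- Lists of terms are not normal forms, so this goes by induction on the total length,
  -- removing every occurrence of one word from both sides.
  sumWith-cong : ∀ g {p q} → p ≈ q → sumWith g p ≡ sumWith g q
  sumWith-cong g {p} {q} = go (length p ℕ.+ length q) p q ℕP.≤-refl
    where
      step : ∀ v p q → p ≈ q → sumWith g (remove v p) ≡ sumWith g (remove v q) → sumWith g p ≡ sumWith g q
      step v p q e ih = trans (sumWith-remove g v p)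
        (trans (cong₂ _+_ (cong (_* g v) (coeff-≡ e v)) ih) (sym (sumWith-remove g v q)))
      go : ∀ k p q → length p ℕ.+ length q ≤ k → p ≈ q → sumWith g p ≡ sumWith g q
      go _ [] [] _ _ = refl
      go zero (_ ∷ _) _ () _
      go zero [] (_ ∷ _) () _
      go (suc k) p₀@((c , v) ∷ p) q (s≤s le) e = step v p₀ q e (go k (remove v p₀) (remove v q)
        (ℕP.≤-trans (ℕP.+-mono-≤ (length-remove-head c v p) (length-remove v q)) le) (remove-cong v e))
      go (suc k) [] q₀@((c , v) ∷ q) (s≤s le) e = step v [] q₀ e (go k [] (remove v q₀)
        (ℕP.≤-trans (length-remove-head c v q) le) (remove-cong v e))

  sumWith-scale : ∀ g a p → sumWith g (scale a p) ≡ a * sumWith g p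
  sumWith-scale g a [] = sym (ℚP.*-zeroʳ a)
  sumWith-scale g a ((c , v) ∷ p) =
    trans (cong₂ _+_ (ℚP.*-assoc a c _) (sumWith-scale g a p)) (sym (ℚP.*-distribˡ-+ a _ _))

  AllWords : (Word → Set) → Poly → Set
  AllWords P = All (λ t → P (proj₂ t))

  allWords : ∀ {P : Word → Set} → (∀ v → P v) → ∀ p → AllWords P p
  allWords h [] = []
  allWords h ((c , v) ∷ p) = h v ∷ allWords h p

  module _ {P : Word → Set} where

    AllWords-⊕ : ∀ {p q} → AllWords P p → AllWords P q → AllWords P (p ⊕ q)
    AllWords-⊕ = AllP.++⁺

    AllWords-scale : ∀ a {p} → AllWords P p → AllWords P (scale a p)
    AllWords-scale a = AllP.map⁺

    AllWords-⊖ : ∀ {p q} → AllWords P p → AllWords P q → AllWords P (p ⊖ q)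
    AllWords-⊖ hp hq = AllWords-⊕ hp (AllWords-scale (- 1ℚ) hq)

    AllWords-Σ≤ : ∀ m {f} → (∀ k → AllWords P (f k)) → AllWords P (Σ≤ m f)
    AllWords-Σ≤ zero h = h 0
    AllWords-Σ≤ (suc m) h = AllWords-⊕ (AllWords-Σ≤ m h) (h (suc m))

  extend : (Word → Poly) → Poly → Poly
  extend f = concatMap (λ { (c , v) → scale c (f v) })

  coeff-extend : ∀ f p u → coeff (extend f p) u ≡ sumWith (λ v → coeff (f v) u) p
  coeff-extend f [] u = refl
  coeff-extend f ((c , v) ∷ p) u = trans (coeff-⊕ (scale c (f v)) (extend f p) u)
    (cong₂ _+_ (coeff-scale c (f v) u) (coeff-extend f p u))

  AllWords-extend : ∀ {P f} → (∀ v → AllWords P (f v)) → ∀ p → AllWords P (extend f p)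
  AllWords-extend h [] = []
  AllWords-extend h ((c , v) ∷ p) = AllWords-⊕ (AllWords-scale c (h v)) (AllWords-extend h p)

  extend-cong : ∀ f {p q} → p ≈ q → extend f p ≈ extend f q
  extend-cong f {p} {q} e = coeffwise λ u →
    trans (coeff-extend f p u) (trans (sumWith-cong _ e) (sym (coeff-extend f q u)))

  extend-⊕ : ∀ f p q → extend f (p ⊕ q) ≡ extend f p ⊕ extend f q
  extend-⊕ f p q = ListP.concatMap-++ _ p q

  extend-scale : ∀ f a p → extend f (scale a p) ≈ scale a (extend f p)
  extend-scale f a p = coeffwise λ u → trans (coeff-extend f (scale a p) u)
    (trans (sumWith-scale _ a p) (sym (trans (coeff-scale a (extend f p) u) (cong (a *_) (coeff-extend f p u)))))

  extend-word : ∀ f v → extend f (word v) ≈ f v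
  extend-word f v = coeffwise λ u → trans (coeff-extend f (word v) u)
    (trans (ℚP.+-identityʳ _) (ℚP.*-identityˡ _))

  extend-congᶠ : ∀ {f g} p → AllWords (λ v → f v ≈ g v) p → extend f p ≈ extend g p
  extend-congᶠ [] [] = ≈-refl
  extend-congᶠ ((c , v) ∷ p) (e ∷ es) = ⊕-cong (scale-cong c e) (extend-congᶠ p es)

  extend-⊕ᶠ : ∀ f g p → extend (λ v → f v ⊕ g v) p ≈ extend f p ⊕ extend g p
  extend-⊕ᶠ f g [] = ≈-refl
  extend-⊕ᶠ f g ((c , v) ∷ p) = ≈-trans (⊕-cong (≡⇒≈ (scale-⊕ c (f v) (g v))) (extend-⊕ᶠ f g p))
    (⊕-interchange (scale c (f v)) (scale c (g v)) (extend f p) (extend g p))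

  extend-scaleᶠ : ∀ a f p → extend (λ v → scale a (f v)) p ≈ scale a (extend f p)
  extend-scaleᶠ a f [] = ≈-refl
  extend-scaleᶠ a f ((c , v) ∷ p) = ≈-trans (⊕-cong (≈-trans (scale-* c a (f v))
      (≈-trans (≡⇒≈ (cong (λ r → scale r (f v)) (ℚP.*-comm c a))) (≈-sym (scale-* a c (f v))))) (extend-scaleᶠ a f p))
    (≡⇒≈ (sym (scale-⊕ a (scale c (f v)) (extend f p))))

  record IsLinear (F : Poly → Poly) : Set where
    field
      ≈-cong : ∀ {p q} → p ≈ q → F p ≈ F q
      ⊕-homo : ∀ p q → F (p ⊕ q) ≈ F p ⊕ F q
      scale-homo : ∀ a p → F (scale a p) ≈ scale a (F p)

    ⊖-homo : ∀ p q → F (p ⊖ q) ≈ F p ⊖ F q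
    ⊖-homo p q = ≈-trans (⊕-homo p (scale (- 1ℚ) q)) (⊕-congˡ (F p) (scale-homo (- 1ℚ) q))

    ⊕₃-homo : ∀ p q r → F (p ⊕ q ⊕ r) ≈ F p ⊕ F q ⊕ F r
    ⊕₃-homo p q r = ≈-trans (⊕-homo (p ⊕ q) r) (⊕-congʳ (F r) (⊕-homo p q))

  linear-≈-extend : ∀ {F} → IsLinear F → ∀ p → F p ≈ extend (λ v → F (word v)) p
  linear-≈-extend {F} L [] = ≈-trans (IsLinear.scale-homo L 0ℚ []) (scale-0 (F []))
  linear-≈-extend {F} L ((c , v) ∷ p) = ≈-trans (IsLinear.⊕-homo L ((c , v) ∷ []) p)
    (⊕-cong (≈-trans (IsLinear.≈-cong L (singleton≈scale-word c v)) (IsLinear.scale-homo L c (word v)))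
            (linear-≈-extend L p))

  linear-≈-on : ∀ {F G} → IsLinear F → IsLinear G → ∀ p → AllWords (λ v → F (word v) ≈ G (word v)) p → F p ≈ G p
  linear-≈-on LF LG p h = ≈-trans (linear-≈-extend LF p) (≈-trans (extend-congᶠ p h) (≈-sym (linear-≈-extend LG p)))

  linear-≈ : ∀ {F G} → IsLinear F → IsLinear G → (∀ v → F (word v) ≈ G (word v)) → ∀ p → F p ≈ G p
  linear-≈ LF LG h p = linear-≈-on LF LG p (allWords h p)

  linear-resp : ∀ {F G} → IsLinear F → (∀ p → G p ≈ F p) → IsLinear G
  linear-resp {F} {G} L e = record
    { ≈-cong = λ {p} {q} p≈q → ≈-trans (e p) (≈-trans (IsLinear.≈-cong L p≈q) (≈-sym (e q)))
    ; ⊕-homo = λ p q → ≈-trans (e (p ⊕ q)) (≈-trans (IsLinear.⊕-homo L p q) (⊕-cong (≈-sym (e p)) (≈-sym (e q))))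
    ; scale-homo = λ a p → ≈-trans (e (scale a p)) (≈-trans (IsLinear.scale-homo L a p) (scale-cong a (≈-sym (e p)))) }

  id-linear : IsLinear (λ p → p)
  id-linear = record { ≈-cong = λ e → e ; ⊕-homo = λ _ _ → ≈-refl ; scale-homo = λ _ _ → ≈-refl }

  ∘-linear : ∀ {F G} → IsLinear F → IsLinear G → IsLinear (λ p → F (G p))
  ∘-linear LF LG = record
    { ≈-cong = λ e → IsLinear.≈-cong LF (IsLinear.≈-cong LG e)
    ; ⊕-homo = λ p q → ≈-trans (IsLinear.≈-cong LF (IsLinear.⊕-homo LG p q)) (IsLinear.⊕-homo LF _ _)
    ; scale-homo = λ a p → ≈-trans (IsLinear.≈-cong LF (IsLinear.scale-homo LG a p)) (IsLinear.scale-homo LF a _) }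

  ⊕-linear : ∀ {F G} → IsLinear F → IsLinear G → IsLinear (λ p → F p ⊕ G p)
  ⊕-linear {F} {G} LF LG = record
    { ≈-cong = λ e → ⊕-cong (IsLinear.≈-cong LF e) (IsLinear.≈-cong LG e)
    ; ⊕-homo = λ p q → ≈-trans (⊕-cong (IsLinear.⊕-homo LF p q) (IsLinear.⊕-homo LG p q))
        (⊕-interchange (F p) (F q) (G p) (G q))
    ; scale-homo = λ a p → ≈-trans (⊕-cong (IsLinear.scale-homo LF a p) (IsLinear.scale-homo LG a p))
        (≡⇒≈ (sym (scale-⊕ a (F p) (G p)))) }

  scale-linear : ∀ a {F} → IsLinear F → IsLinear (λ p → scale a (F p))
  scale-linear a {F} LF = record
    { ≈-cong = λ e → scale-cong a (IsLinear.≈-cong LF e)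
    ; ⊕-homo = λ p q → ≈-trans (scale-cong a (IsLinear.⊕-homo LF p q)) (≡⇒≈ (scale-⊕ a (F p) (F q)))
    ; scale-homo = λ b p → ≈-trans (scale-cong a (IsLinear.scale-homo LF b p)) (≈-trans (scale-* a b _)
        (≈-trans (≡⇒≈ (cong (λ r → scale r (F p)) (ℚP.*-comm a b))) (≈-sym (scale-* b a _)))) }

  ⊖-linear : ∀ {F G} → IsLinear F → IsLinear G → IsLinear (λ p → F p ⊖ G p)
  ⊖-linear LF LG = ⊕-linear LF (scale-linear (- 1ℚ) LG)

  extend-linear : ∀ f → IsLinear (extend f)
  extend-linear f = record
    { ≈-cong = extend-cong f ; ⊕-homo = λ p q → ≡⇒≈ (extend-⊕ f p q) ; scale-homo = extend-scale f }

  record IsBilinear (_∙_ : Poly → Poly → Poly) : Set where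
    field
      linearˡ : ∀ q → IsLinear (_∙ q)
      linearʳ : ∀ p → IsLinear (p ∙_)

    ∙-congˡ : ∀ p {q q′} → q ≈ q′ → p ∙ q ≈ p ∙ q′
    ∙-congˡ p = IsLinear.≈-cong (linearʳ p)

    ∙-congʳ : ∀ q {p p′} → p ≈ p′ → p ∙ q ≈ p′ ∙ q
    ∙-congʳ q = IsLinear.≈-cong (linearˡ q)

    ∙-cong : ∀ {p p′ q q′} → p ≈ p′ → q ≈ q′ → p ∙ q ≈ p′ ∙ q′
    ∙-cong {p′ = p′} {q = q} e f = ≈-trans (∙-congʳ q e) (∙-congˡ p′ f)

  bilinear : (Word → Word → Poly) → Poly → Poly → Poly
  bilinear b p q = extend (λ u → extend (b u) q) p

  bilinear-isBilinear : ∀ b → IsBilinear (bilinear b)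
  bilinear-isBilinear b = record
    { linearˡ = λ q → extend-linear _
    ; linearʳ = λ p → record
      { ≈-cong = λ e → extend-congᶠ p (allWords (λ u → extend-cong (b u) e) p)
      ; ⊕-homo = λ q q′ → ≈-trans (extend-congᶠ p (allWords (λ u → ≡⇒≈ (extend-⊕ (b u) q q′)) p))
          (extend-⊕ᶠ _ _ p)
      ; scale-homo = λ a q → ≈-trans (extend-congᶠ p (allWords (λ u → extend-scale (b u) a q) p)) (extend-scaleᶠ a _ p) } }

  bilinear-word : ∀ b u v → bilinear b (word u) (word v) ≈ b u v
  bilinear-word b u v = ≈-trans (extend-word (λ u′ → extend (b u′) (word v)) u) (extend-word (b u) v)

  isBilinear-resp : ∀ {_∙_ b} → (∀ p q → p ∙ q ≈ bilinear b p q) → IsBilinear _∙_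
  isBilinear-resp {b = b} e = record
    { linearˡ = λ q → linear-resp (IsBilinear.linearˡ (bilinear-isBilinear b) q) (λ p → e p q)
    ; linearʳ = λ p → linear-resp (IsBilinear.linearʳ (bilinear-isBilinear b) p) (e p) }

  bilinear-≈-on : ∀ {F G : Poly → Poly → Poly} {P Q : Word → Set} → IsBilinear F → IsBilinear G →
    (∀ u v → P u → Q v → F (word u) (word v) ≈ G (word u) (word v)) →
    ∀ p q → AllWords P p → AllWords Q q → F p q ≈ G p q
  bilinear-≈-on BF BG h p q hp hq = linear-≈-on (IsBilinear.linearˡ BF q) (IsBilinear.linearˡ BG q) p
    (All.map (λ {t} Pu → linear-≈-on (IsBilinear.linearʳ BF (word (proj₂ t))) (IsBilinear.linearʳ BG (word (proj₂ t))) q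
      (All.map (λ {t′} Qv → h (proj₂ t) (proj₂ t′) Pu Qv) hq)) hp)

  bilinear-≈ : ∀ {F G : Poly → Poly → Poly} → IsBilinear F → IsBilinear G →
    (∀ u v → F (word u) (word v) ≈ G (word u) (word v)) → ∀ p q → F p q ≈ G p q
  bilinear-≈ {F} {G} BF BG h p q =
    bilinear-≈-on {P = λ _ → ⊤} {Q = λ _ → ⊤} BF BG (λ u v _ _ → h u v) p q (allWords _ p) (allWords _ q)

  bilinear-assoc : ∀ {_∙_} → IsBilinear _∙_ →
    (∀ u v w → (word u ∙ word v) ∙ word w ≈ word u ∙ (word v ∙ word w)) → ∀ p q r → (p ∙ q) ∙ r ≈ p ∙ (q ∙ r)
  bilinear-assoc {_∙_} B assoc-words p q r = bilinear-≈ {F = λ p q → (p ∙ q) ∙ r} {G = λ p q → p ∙ (q ∙ r)}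
    (record { linearˡ = λ q → ∘-linear (linearˡ r) (linearˡ q) ; linearʳ = λ p → ∘-linear (linearˡ r) (linearʳ p) })
    (record { linearˡ = λ q → linearˡ (q ∙ r) ; linearʳ = λ p → ∘-linear (linearʳ p) (linearˡ r) })
    (λ u v → linear-≈ {F = λ r → (word u ∙ word v) ∙ r} {G = λ r → word u ∙ (word v ∙ r)}
      (linearʳ (word u ∙ word v)) (∘-linear (linearʳ (word u)) (linearʳ (word v))) (assoc-words u v) r)
    p q
    where open IsBilinear B

  prefix≈extend : ∀ x p → prefix x p ≈ extend (λ v → word (x ∷ v)) p
  prefix≈extend x [] = ≈-refl
  prefix≈extend x ((c , v) ∷ p) = ⊕-cong (singleton≈scale-word c (x ∷ v)) (prefix≈extend x p)

  prefix-linear : ∀ x → IsLinear (prefix x)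
  prefix-linear x = linear-resp (extend-linear (λ v → word (x ∷ v))) (prefix≈extend x)

  prefix-cong : ∀ x {p q} → p ≈ q → prefix x p ≈ prefix x q
  prefix-cong x = IsLinear.≈-cong (prefix-linear x)

  prefix-⊕ : ∀ x p q → prefix x (p ⊕ q) ≡ prefix x p ⊕ prefix x q
  prefix-⊕ x = ListP.map-++ _

  ·≈bilinear : ∀ p q → p · q ≈ bilinear (λ u v → word (u ++ v)) p q
  ·≈bilinear [] q = ≈-refl
  ·≈bilinear ((c , u) ∷ p) q = ⊕-cong (left-multiple q) (·≈bilinear p q)
    where
      left-multiple : ∀ q → map (λ { (d , v) → (c * d , u ++ v) }) q ≈ scale c (extend (λ v → word (u ++ v)) q)
      left-multiple [] = ≈-refl
      left-multiple ((d , v) ∷ q) = ⊕-cong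
        (≈-trans (singleton≈scale-word (c * d) (u ++ v)) (≈-sym (scale-* c d (word (u ++ v))))) (left-multiple q)

  ·-isBilinear : IsBilinear _·_
  ·-isBilinear = isBilinear-resp {b = λ u v → word (u ++ v)} ·≈bilinear

  ·-linearˡ : ∀ q → IsLinear (_· q)
  ·-linearˡ = IsBilinear.linearˡ ·-isBilinear

  ·-linearʳ : ∀ p → IsLinear (p ·_)
  ·-linearʳ = IsBilinear.linearʳ ·-isBilinear

  open IsBilinear ·-isBilinear using () renaming (∙-cong to ·-cong; ∙-congˡ to ·-congˡ; ∙-congʳ to ·-congʳ)

  ·-word : ∀ u v → word u · word v ≈ word (u ++ v)
  ·-word u v = ≈-trans (·≈bilinear (word u) (word v)) (bilinear-word (λ u v → word (u ++ v)) u v)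

  ⊕-· : ∀ p p′ q → (p ⊕ p′) · q ≡ p · q ⊕ p′ · q
  ⊕-· p p′ q = ListP.concatMap-++ _ p p′

  prefix-· : ∀ x p q → prefix x p · q ≡ prefix x (p · q)
  prefix-· x [] q = refl
  prefix-· x ((c , u) ∷ p) q = trans (cong₂ _⊕_ (prefix-map q) (prefix-· x p q)) (sym (prefix-⊕ x _ (p · q)))
    where
      prefix-map : ∀ q → map (λ { (d , v) → (c * d , (x ∷ u) ++ v) }) q ≡ prefix x (map (λ { (d , v) → (c * d , u ++ v) }) q)
      prefix-map [] = refl
      prefix-map ((d , v) ∷ q) = cong (_ ∷_) (prefix-map q)

  AllWords-· : ∀ {P Q R : Word → Set} → (∀ {u v} → P u → Q v → R (u ++ v)) →
    ∀ {p q} → AllWords P p → AllWords Q q → AllWords R (p · q)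
  AllWords-· h [] hq = []
  AllWords-· h (hu ∷ hp) hq = AllWords-⊕ (AllP.map⁺ (All.map (h hu) hq)) (AllWords-· h hp hq)

  AllWords-prefix : ∀ {P Q : Word → Set} {x} → (∀ {u} → P u → Q (x ∷ u)) →
    ∀ {p} → AllWords P p → AllWords Q (prefix x p)
  AllWords-prefix h hp = AllP.map⁺ (All.map h hp)

  ·-identityˡ : ∀ p → 𝟙 · p ≈ p
  ·-identityˡ = linear-≈ (·-linearʳ 𝟙) id-linear (·-word [])

  ·-identityʳ : ∀ p → p · 𝟙 ≈ p
  ·-identityʳ = linear-≈ (·-linearˡ 𝟙) id-linear
    (λ u → ≈-trans (·-word u []) (≡⇒≈ (cong word (ListP.++-identityʳ u))))

  ·-assoc : ∀ p q r → (p · q) · r ≈ p · (q · r)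
  ·-assoc = bilinear-assoc ·-isBilinear (λ u v w → begin
      (word u · word v) · word w  ≈⟨ ·-congʳ (word w) (·-word u v) ⟩
      word (u ++ v) · word w      ≈⟨ ·-word (u ++ v) w ⟩
      word ((u ++ v) ++ w)        ≡⟨ cong word (ListP.++-assoc u v w) ⟩
      word (u ++ (v ++ w))        ≈⟨ ·-word u (v ++ w) ⟨
      word u · word (v ++ w)      ≈⟨ ·-congˡ (word u) (·-word v w) ⟨
      word u · (word v · word w)  ∎)
    where open ≈-Reasoning

  -- Relative coordinates

  fin : ℕ → Fin N
  fin m = m mod N

  toℕ-fin : ∀ m → toℕ (fin m) ≡ m % N
  toℕ-fin m = FinP.toℕ-fromℕ< _

  fin-cong-% : ∀ a b → a % N ≡ b % N → fin a ≡ fin b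
  fin-cong-% a b e = FinP.toℕ-injective (trans (toℕ-fin a) (trans e (sym (toℕ-fin b))))

  fin-toℕ : ∀ i → fin (toℕ i) ≡ i
  fin-toℕ i = FinP.toℕ-injective (trans (toℕ-fin (toℕ i)) (m<n⇒m%n≡m (FinP.toℕ<n i)))

  fin-toℕ-fin-+ : ∀ a b → fin (toℕ (fin a) ℕ.+ b) ≡ fin (a ℕ.+ b)
  fin-toℕ-fin-+ a b = fin-cong-% (toℕ (fin a) ℕ.+ b) (a ℕ.+ b) (begin
      (toℕ (fin a) ℕ.+ b) % N            ≡⟨ cong (λ x → (x ℕ.+ b) % N) (toℕ-fin a) ⟩
      (a % N ℕ.+ b) % N                  ≡⟨ %-distribˡ-+ (a % N) b N ⟩
      (a % N % N ℕ.+ b % N) % N          ≡⟨ cong (λ x → (x ℕ.+ b % N) % N) (m%n%n≡m%n a N) ⟩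
      (a % N ℕ.+ b % N) % N              ≡⟨ %-distribˡ-+ a b N ⟨
      (a ℕ.+ b) % N                      ∎)
    where open ≡-Reasoning

  fin-+-toℕ-fin : ∀ a b → fin (a ℕ.+ toℕ (fin b)) ≡ fin (a ℕ.+ b)
  fin-+-toℕ-fin a b = trans (cong fin (ℕP.+-comm a _)) (trans (fin-toℕ-fin-+ b a) (cong fin (ℕP.+-comm b a)))

  fin-+-N : ∀ a → fin (a ℕ.+ N) ≡ fin a
  fin-+-N a = fin-cong-% (a ℕ.+ N) a ([m+n]%n≡m%n a N)

  toℕ+negIdx : ∀ i → toℕ i ℕ.+ negIdx i ≡ N
  toℕ+negIdx i = ℕP.m+[n∸m]≡n (ℕP.<⇒≤ (FinP.toℕ<n i))

  τ-τ : ∀ j k w → τ j (τ k w) ≡ τ (k ℕ.+ j) w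
  τ-τ j k [] = refl
  τ-τ j k (y e i ∷ w) = cong₂ _∷_
    (cong (y e) (trans (fin-toℕ-fin-+ (toℕ i ℕ.+ k) j) (cong fin (ℕP.+-assoc (toℕ i) k j)))) (τ-τ j k w)

  τ-toℕ-fin : ∀ j w → τ (toℕ (fin j)) w ≡ τ j w
  τ-toℕ-fin j [] = refl
  τ-toℕ-fin j (y e i ∷ w) = cong₂ _∷_ (cong (y e) (fin-+-toℕ-fin (toℕ i) j)) (τ-toℕ-fin j w)

  τ-N : ∀ w → τ N w ≡ w
  τ-N [] = refl
  τ-N (y e i ∷ w) = cong₂ _∷_ (cong (y e) (trans (fin-+-N (toℕ i)) (fin-toℕ i))) (τ-N w)

  τ-0 : ∀ w → τ 0 w ≡ w
  τ-0 [] = refl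
  τ-0 (y e i ∷ w) = cong₂ _∷_ (cong (y e) (trans (cong fin (ℕP.+-identityʳ (toℕ i))) (fin-toℕ i))) (τ-0 w)

  τ-negIdx-τ : ∀ i w → τ (negIdx i) (τ (toℕ i) w) ≡ w
  τ-negIdx-τ i w = trans (τ-τ (negIdx i) (toℕ i) w) (trans (cong (λ k → τ k w) (toℕ+negIdx i)) (τ-N w))

  -- A word in relative coordinates records each index as an offset from the index of the
  -- preceding letter; toAbsolute turns offsets into partial sums.  The twisted stuffle
  -- shifts the tail by the index of the first letter, so in relative coordinates it
  -- becomes the ordinary quasi-shuffle.
  toAbsolute : Word → Word
  toAbsolute [] = []
  toAbsolute (y e i ∷ a) = y e i ∷ τ (toℕ i) (toAbsolute a)

  toRelativeFrom : Fin N → Word → Word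
  toRelativeFrom p [] = []
  toRelativeFrom p (y e i ∷ u) = y e (fin (toℕ i ℕ.+ negIdx p)) ∷ toRelativeFrom i u

  toRelative : Word → Word
  toRelative = toRelativeFrom Fin.zero

  toAbsolute-toRelativeFrom : ∀ p u → τ (toℕ p) (toAbsolute (toRelativeFrom p u)) ≡ u
  toAbsolute-toRelativeFrom p [] = refl
  toAbsolute-toRelativeFrom p (y e i ∷ u) = cong₂ _∷_ (cong (y e) head-index)
    (begin
      τ (toℕ p) (τ (toℕ d) (toAbsolute (toRelativeFrom i u)))   ≡⟨ τ-τ (toℕ p) (toℕ d) _ ⟩
      τ (toℕ d ℕ.+ toℕ p) (toAbsolute (toRelativeFrom i u))    ≡⟨ τ-toℕ-fin (toℕ d ℕ.+ toℕ p) _ ⟨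
      τ (toℕ (fin (toℕ d ℕ.+ toℕ p))) (toAbsolute (toRelativeFrom i u))  ≡⟨ cong (λ j → τ (toℕ j) _) head-index ⟩
      τ (toℕ i) (toAbsolute (toRelativeFrom i u))              ≡⟨ toAbsolute-toRelativeFrom i u ⟩
      u                                                        ∎)
    where
      open ≡-Reasoning
      d = fin (toℕ i ℕ.+ negIdx p)
      head-index : fin (toℕ d ℕ.+ toℕ p) ≡ i
      head-index = trans (fin-toℕ-fin-+ (toℕ i ℕ.+ negIdx p) (toℕ p)) (trans (cong fin (trans (ℕP.+-assoc (toℕ i) _ _)
        (cong (toℕ i ℕ.+_) (trans (ℕP.+-comm (negIdx p) (toℕ p)) (toℕ+negIdx p))))) (trans (fin-+-N (toℕ i)) (fin-toℕ i)))

  toAbsolute-toRelative : ∀ u → toAbsolute (toRelative u) ≡ u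
  toAbsolute-toRelative u = trans (sym (τ-0 _)) (toAbsolute-toRelativeFrom Fin.zero u)

  toRelativeFrom-toAbsolute : ∀ p a → toRelativeFrom p (τ (toℕ p) (toAbsolute a)) ≡ a
  toRelativeFrom-toAbsolute p [] = refl
  toRelativeFrom-toAbsolute p (y e i ∷ a) = cong₂ _∷_ (cong (y e) head-index)
    (trans (cong (toRelativeFrom j) (trans (τ-τ (toℕ p) (toℕ i) (toAbsolute a)) (sym (τ-toℕ-fin (toℕ i ℕ.+ toℕ p) _))))
      (toRelativeFrom-toAbsolute j a))
    where
      j = fin (toℕ i ℕ.+ toℕ p)
      head-index : fin (toℕ j ℕ.+ negIdx p) ≡ i
      head-index = trans (fin-toℕ-fin-+ (toℕ i ℕ.+ toℕ p) (negIdx p)) (trans (cong fin (trans (ℕP.+-assoc (toℕ i) _ _)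
        (cong (toℕ i ℕ.+_) (toℕ+negIdx p)))) (trans (fin-+-N (toℕ i)) (fin-toℕ i)))

  toRelative-toAbsolute : ∀ a → toRelative (toAbsolute a) ≡ a
  toRelative-toAbsolute a = trans (cong toRelative (sym (τ-0 _))) (toRelativeFrom-toAbsolute Fin.zero a)

  wt-toRelativeFrom : ∀ p u → wt (toRelativeFrom p u) ≡ wt u
  wt-toRelativeFrom p [] = refl
  wt-toRelativeFrom p (y e i ∷ u) = cong (suc e ℕ.+_) (wt-toRelativeFrom i u)

  length-toAbsolute : ∀ a → length (toAbsolute a) ≡ length a
  length-toAbsolute [] = refl
  length-toAbsolute (y e i ∷ a) = cong suc (trans (ListP.length-map _ (toAbsolute a)) (length-toAbsolute a))

  toAbsoluteP : Poly → Poly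
  toAbsoluteP = map (λ { (c , w) → (c , toAbsolute w) })

  toRelativeP : Poly → Poly
  toRelativeP = map (λ { (c , w) → (c , toRelative w) })

  coeff-toAbsoluteP : ∀ p u → coeff (toAbsoluteP p) u ≡ coeff p (toRelative u)
  coeff-toAbsoluteP [] u = refl
  coeff-toAbsoluteP ((c , w) ∷ p) u with toAbsolute w ≟W u | w ≟W toRelative u
  ... | yes _ | yes _ = cong (c +_) (coeff-toAbsoluteP p u)
  ... | no _ | no _ = coeff-toAbsoluteP p u
  ... | yes e | no ne = ⊥-elim (ne (trans (sym (toRelative-toAbsolute w)) (cong toRelative e)))
  ... | no ne | yes e = ⊥-elim (ne (trans (cong toAbsolute e) (toAbsolute-toRelative u)))

  toAbsoluteP-toRelativeP : ∀ p → toAbsoluteP (toRelativeP p) ≡ p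
  toAbsoluteP-toRelativeP [] = refl
  toAbsoluteP-toRelativeP ((c , w) ∷ p) = cong₂ _∷_ (cong (c ,_) (toAbsolute-toRelative w)) (toAbsoluteP-toRelativeP p)

  toAbsoluteP-⊕ : ∀ p q → toAbsoluteP (p ⊕ q) ≡ toAbsoluteP p ⊕ toAbsoluteP q
  toAbsoluteP-⊕ = ListP.map-++ _

  toAbsoluteP-scale : ∀ a p → toAbsoluteP (scale a p) ≡ scale a (toAbsoluteP p)
  toAbsoluteP-scale a [] = refl
  toAbsoluteP-scale a ((c , w) ∷ p) = cong (_ ∷_) (toAbsoluteP-scale a p)

  toAbsoluteP-⊖ : ∀ p q → toAbsoluteP (p ⊖ q) ≡ toAbsoluteP p ⊖ toAbsoluteP q
  toAbsoluteP-⊖ p q = trans (toAbsoluteP-⊕ p _) (cong (toAbsoluteP p ⊕_) (toAbsoluteP-scale (- 1ℚ) q))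

  -- The untwisted quasi-shuffle

  merge : Y → Y → Y
  merge (y s j) (y t k) = y (suc (s ℕ.+ t)) (shiftIdx (toℕ k) j)

  quasiShuffle : Word → Word → Poly
  quasiShuffle [] b = word b
  quasiShuffle (x ∷ a) [] = word (x ∷ a)
  quasiShuffle (x ∷ a) (v ∷ b) =
      prefix x (quasiShuffle a (v ∷ b))
    ⊕ prefix v (quasiShuffle (x ∷ a) b)
    ⊕ prefix (merge x v) (quasiShuffle a b)

  prefix-τP-toAbsoluteP : ∀ e i m p → (∀ w → τ m w ≡ τ (toℕ i) w) →
    prefix (y e i) (τP m (toAbsoluteP p)) ≡ toAbsoluteP (prefix (y e i) p)
  prefix-τP-toAbsoluteP e i m [] h = refl
  prefix-τP-toAbsoluteP e i m ((c , w) ∷ p) h =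
    cong₂ _∷_ (cong (λ v → c , y e i ∷ v) (h (toAbsolute w))) (prefix-τP-toAbsoluteP e i m p h)

  stf-toAbsolute : ∀ f a b → length a ℕ.+ length b ≤ f → stf f (toAbsolute a) (toAbsolute b) ≡ toAbsoluteP (quasiShuffle a b)
  stf-toAbsolute f [] b le = refl
  stf-toAbsolute f (y e i ∷ a) [] le = refl
  stf-toAbsolute zero (y s j ∷ a) (y t k ∷ b) ()
  stf-toAbsolute (suc f) (y s j ∷ a) (y t k ∷ b) (s≤s le) = begin
      left ⊕ right ⊕ merged
    ≡⟨ cong₂ _⊕_ (cong₂ _⊕_ left≡ right≡) merged≡ ⟩
      toAbsoluteP L ⊕ toAbsoluteP R ⊕ toAbsoluteP M
    ≡⟨ sym (trans (toAbsoluteP-⊕ (L ⊕ R) M) (cong (_⊕ toAbsoluteP M) (toAbsoluteP-⊕ L R))) ⟩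
      toAbsoluteP (quasiShuffle (y s j ∷ a) (y t k ∷ b))
    ∎
    where
      open ≡-Reasoning
      a′ = toAbsolute a
      b′ = toAbsolute b
      L = prefix (y s j) (quasiShuffle a (y t k ∷ b))
      R = prefix (y t k) (quasiShuffle (y s j ∷ a) b)
      M = prefix (merge (y s j) (y t k)) (quasiShuffle a b)
      left = prefix (y s j) (τP (toℕ j) (stf f (τ (negIdx j) (τ (toℕ j) a′)) (y t k ∷ τ (toℕ k) b′)))
      right = prefix (y t k) (τP (toℕ k) (stf f (y s j ∷ τ (toℕ j) a′) (τ (negIdx k) (τ (toℕ k) b′))))
      merged = prefix (y (suc (s ℕ.+ t)) (shiftIdx (toℕ k) j))
        (τP (toℕ j ℕ.+ toℕ k) (stf f (τ (negIdx j) (τ (toℕ j) a′)) (τ (negIdx k) (τ (toℕ k) b′))))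
      left≡ = trans (cong (λ v → prefix (y s j) (τP (toℕ j) (stf f v (toAbsolute (y t k ∷ b))))) (τ-negIdx-τ j a′))
        (trans (cong (λ v → prefix (y s j) (τP (toℕ j) v)) (stf-toAbsolute f a (y t k ∷ b) le))
          (prefix-τP-toAbsoluteP s j (toℕ j) (quasiShuffle a (y t k ∷ b)) (λ _ → refl)))
      right≡ = trans (cong (λ v → prefix (y t k) (τP (toℕ k) (stf f (toAbsolute (y s j ∷ a)) v))) (τ-negIdx-τ k b′))
        (trans (cong (λ v → prefix (y t k) (τP (toℕ k) v))
            (stf-toAbsolute f (y s j ∷ a) b (ℕP.≤-trans (ℕP.≤-reflexive (sym (ℕP.+-suc (length a) (length b)))) le)))
          (prefix-τP-toAbsoluteP t k (toℕ k) (quasiShuffle (y s j ∷ a) b) (λ _ → refl)))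
      merged≡ = trans (cong₂ (λ v v′ → prefix (merge (y s j) (y t k)) (τP (toℕ j ℕ.+ toℕ k) (stf f v v′)))
                             (τ-negIdx-τ j a′) (τ-negIdx-τ k b′))
        (trans (cong (λ v → prefix (merge (y s j) (y t k)) (τP (toℕ j ℕ.+ toℕ k) v))
            (stf-toAbsolute f a b (ℕP.≤-trans (ℕP.+-monoʳ-≤ (length a) (ℕP.n≤1+n (length b))) le)))
          (prefix-τP-toAbsoluteP (suc (s ℕ.+ t)) (shiftIdx (toℕ k) j) (toℕ j ℕ.+ toℕ k) (quasiShuffle a b)
            (λ w → sym (τ-toℕ-fin (toℕ j ℕ.+ toℕ k) w))))

  wstuffle-toAbsolute : ∀ a b → wstuffle (toAbsolute a) (toAbsolute b) ≡ toAbsoluteP (quasiShuffle a b)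
  wstuffle-toAbsolute a b =
    stf-toAbsolute _ a b (ℕP.≤-reflexive (sym (cong₂ ℕ._+_ (length-toAbsolute a) (length-toAbsolute b))))

  infixl 7 _⋆₀_
  _⋆₀_ : Poly → Poly → Poly
  p ⋆₀ q = concatMap (λ { (c , u) → concatMap (λ { (d , v) → scale (c * d) (quasiShuffle u v) }) q }) p

  toAbsoluteP-⋆₀ : ∀ p q → toAbsoluteP p ⋆ toAbsoluteP q ≡ toAbsoluteP (p ⋆₀ q)
  toAbsoluteP-⋆₀ [] q = refl
  toAbsoluteP-⋆₀ ((c , u) ∷ p) q = trans (cong₂ _⊕_ (row q) (toAbsoluteP-⋆₀ p q)) (sym (toAbsoluteP-⊕ _ (p ⋆₀ q)))
    where
      row : ∀ q → concatMap (λ { (d , v) → scale (c * d) (wstuffle (toAbsolute u) v) }) (toAbsoluteP q)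
                ≡ toAbsoluteP (concatMap (λ { (d , v) → scale (c * d) (quasiShuffle u v) }) q)
      row [] = refl
      row ((d , v) ∷ q) = trans (cong₂ _⊕_ (trans (cong (scale (c * d)) (wstuffle-toAbsolute u v))
          (sym (toAbsoluteP-scale (c * d) (quasiShuffle u v)))) (row q))
        (sym (toAbsoluteP-⊕ (scale (c * d) (quasiShuffle u v)) _))

  δ₀ : Poly → Poly → Poly
  δ₀ z w = (z ⋆₀ w) ⊖ (z · w)

  δ₀^ : ℕ → Poly → Poly → Poly
  δ₀^ zero z w = w
  δ₀^ (suc k) z w = δ₀ z (δ₀^ k z w)

  _∘₀_ : Poly → Poly → Poly
  z ∘₀ z′ = (z ⋆₀ z′) ⊖ (z · z′) ⊖ (z′ · z)

  starPow₀ : Poly → ℕ → Poly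
  starPow₀ z zero = 𝟙
  starPow₀ z (suc k) = z ⋆₀ starPow₀ z k

  circPowS₀ : Poly → ℕ → Poly
  circPowS₀ z zero = z
  circPowS₀ z (suc k) = z ∘₀ circPowS₀ z k

  expδ₀ : ℕ → Poly → Poly → Poly
  expδ₀ m z w = Σ≤ m (λ k → scale (invFact k) (δ₀^ k z w))

  exp⋆₀ : ℕ → Poly → Poly
  exp⋆₀ m z = Σ≤ m (λ k → scale (invFact k) (starPow₀ z k))

  exp∘∘₀ : ℕ → Poly → Poly → Poly
  exp∘∘₀ m z z′ = z′ ⊕ Σ≤ m (λ k → scale (invFact (suc k)) (circPowS₀ z k ∘₀ z′))

  IndexZero : Word → Set
  IndexZero = All (λ x → Y.i x ≡ Fin.zero)

  IndexZeroP : Poly → Set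
  IndexZeroP = AllWords IndexZero

  toAbsolute-indexZero : ∀ {u} → IndexZero u → toAbsolute u ≡ u
  toAbsolute-indexZero [] = refl
  toAbsolute-indexZero {y e .Fin.zero ∷ u} (refl ∷ h) = cong (y e Fin.zero ∷_) (trans (τ-0 _) (toAbsolute-indexZero h))

  toAbsolute-++ : ∀ {u} v → IndexZero u → toAbsolute (u ++ v) ≡ u ++ toAbsolute v
  toAbsolute-++ v [] = refl
  toAbsolute-++ {y e .Fin.zero ∷ u} v (refl ∷ h) = cong (y e Fin.zero ∷_) (trans (τ-0 _) (toAbsolute-++ v h))

  toAbsoluteP-indexZero : ∀ {p} → IndexZeroP p → toAbsoluteP p ≡ p
  toAbsoluteP-indexZero [] = refl
  toAbsoluteP-indexZero {(c , u) ∷ p} (h ∷ hs) = cong₂ _∷_ (cong (c ,_) (toAbsolute-indexZero h)) (toAbsoluteP-indexZero hs)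

  ·-toAbsoluteP : ∀ {p} q → IndexZeroP p → p · toAbsoluteP q ≡ toAbsoluteP (p · q)
  ·-toAbsoluteP q [] = refl
  ·-toAbsoluteP {(c , u) ∷ p} q (h ∷ hs) = trans (cong₂ _⊕_ (row q) (·-toAbsoluteP q hs)) (sym (toAbsoluteP-⊕ _ (p · q)))
    where
      row : ∀ q → map (λ { (d , v) → (c * d , u ++ v) }) (toAbsoluteP q)
                ≡ toAbsoluteP (map (λ { (d , v) → (c * d , u ++ v) }) q)
      row [] = refl
      row ((d , v) ∷ q) = cong₂ _∷_ (cong (c * d ,_) (sym (toAbsolute-++ v h))) (row q)

  indexZero-++ : ∀ {u v} → IndexZero u → IndexZero v → IndexZero (u ++ v)
  indexZero-++ [] hv = hv
  indexZero-++ (h ∷ hu) hv = h ∷ indexZero-++ hu hv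


  AllWords-⋆₀ : ∀ {P Q R : Word → Set} → (∀ {u v} → P u → Q v → AllWords R (quasiShuffle u v)) →
    ∀ {p q} → AllWords P p → AllWords Q q → AllWords R (p ⋆₀ q)
  AllWords-⋆₀ h [] hq = []
  AllWords-⋆₀ {R = R} h {(c , u) ∷ p} (hu ∷ hp) hq = AllWords-⊕ (row hq) (AllWords-⋆₀ h hp hq)
    where
      row : ∀ {q} → All _ q → AllWords R (concatMap (λ { (d , v) → scale (c * d) (quasiShuffle u v) }) q)
      row [] = []
      row {(d , v) ∷ q} (hv ∷ hq) = AllWords-⊕ (AllWords-scale (c * d) (h hu hv)) (row hq)

  indexZero-quasiShuffle : ∀ {u v} → IndexZero u → IndexZero v → IndexZeroP (quasiShuffle u v)
  indexZero-quasiShuffle {[]} [] hv = hv ∷ []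
  indexZero-quasiShuffle {_ ∷ _} {[]} hu [] = hu ∷ []
  indexZero-quasiShuffle {y s .Fin.zero ∷ u} {y t .Fin.zero ∷ v} (refl ∷ hu) (refl ∷ hv) =
    AllWords-⊕ (AllWords-⊕ (AllWords-prefix (refl ∷_) (indexZero-quasiShuffle hu (refl ∷ hv)))
                           (AllWords-prefix (refl ∷_) (indexZero-quasiShuffle (refl ∷ hu) hv)))
               (AllWords-prefix (fin-toℕ Fin.zero ∷_) (indexZero-quasiShuffle hu hv))

  indexZero-· : ∀ {p q} → IndexZeroP p → IndexZeroP q → IndexZeroP (p · q)
  indexZero-· = AllWords-· indexZero-++

  indexZero-⋆₀ : ∀ {p q} → IndexZeroP p → IndexZeroP q → IndexZeroP (p ⋆₀ q)
  indexZero-⋆₀ = AllWords-⋆₀ indexZero-quasiShuffle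

  indexZero-∘₀ : ∀ {p q} → IndexZeroP p → IndexZeroP q → IndexZeroP (p ∘₀ q)
  indexZero-∘₀ hp hq = AllWords-⊖ (AllWords-⊖ (indexZero-⋆₀ hp hq) (indexZero-· hp hq)) (indexZero-· hq hp)

  indexZero-𝟙 : IndexZeroP 𝟙
  indexZero-𝟙 = [] ∷ []

  indexZero-toP : ∀ z → IndexZeroP (toP z)
  indexZero-toP [] = []
  indexZero-toP (_ ∷ z) = (refl ∷ []) ∷ indexZero-toP z

  indexZero-starPow₀ : ∀ {z} → IndexZeroP z → ∀ k → IndexZeroP (starPow₀ z k)
  indexZero-starPow₀ hz zero = indexZero-𝟙
  indexZero-starPow₀ hz (suc k) = indexZero-⋆₀ hz (indexZero-starPow₀ hz k)

  indexZero-circPowS₀ : ∀ {z} → IndexZeroP z → ∀ k → IndexZeroP (circPowS₀ z k)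
  indexZero-circPowS₀ hz zero = hz
  indexZero-circPowS₀ hz (suc k) = indexZero-∘₀ hz (indexZero-circPowS₀ hz k)

  indexZero-exp⋆₀ : ∀ m {z} → IndexZeroP z → IndexZeroP (exp⋆₀ m z)
  indexZero-exp⋆₀ m hz = AllWords-Σ≤ m (λ k → AllWords-scale (invFact k) (indexZero-starPow₀ hz k))

  indexZero-exp∘∘₀ : ∀ m {z z′} → IndexZeroP z → IndexZeroP z′ → IndexZeroP (exp∘∘₀ m z z′)
  indexZero-exp∘∘₀ m hz hz′ =
    AllWords-⊕ hz′ (AllWords-Σ≤ m (λ k → AllWords-scale (invFact (suc k)) (indexZero-∘₀ (indexZero-circPowS₀ hz k) hz′)))

  indexZero-catPow : ∀ {p} → IndexZeroP p → ∀ k → IndexZeroP (catPow p k)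
  indexZero-catPow hp zero = indexZero-𝟙
  indexZero-catPow hp (suc k) = indexZero-· hp (indexZero-catPow hp k)

  indexZero-invCat : ∀ m {p} → IndexZeroP p → IndexZeroP (invCat m p)
  indexZero-invCat m hp = AllWords-Σ≤ m (λ k → indexZero-catPow (AllWords-⊖ indexZero-𝟙 hp) k)

  ⋆≡⋆₀ : ∀ {p q} → IndexZeroP p → IndexZeroP q → p ⋆ q ≡ p ⋆₀ q
  ⋆≡⋆₀ {p} {q} hp hq = begin
    p ⋆ q                              ≡⟨ cong₂ _⋆_ (toAbsoluteP-indexZero hp) (toAbsoluteP-indexZero hq) ⟨
    toAbsoluteP p ⋆ toAbsoluteP q      ≡⟨ toAbsoluteP-⋆₀ p q ⟩
    toAbsoluteP (p ⋆₀ q)               ≡⟨ toAbsoluteP-indexZero (indexZero-⋆₀ hp hq) ⟩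
    p ⋆₀ q                             ∎
    where open ≡-Reasoning

  ∘≡∘₀ : ∀ {p q} → IndexZeroP p → IndexZeroP q → p ∘ q ≡ p ∘₀ q
  ∘≡∘₀ {p} {q} hp hq = cong (λ r → r ⊖ (p · q) ⊖ (q · p)) (⋆≡⋆₀ hp hq)

  starPow≡starPow₀ : ∀ {z} → IndexZeroP z → ∀ k → starPow z k ≡ starPow₀ z k
  starPow≡starPow₀ hz zero = refl
  starPow≡starPow₀ {z} hz (suc k) = trans (cong (z ⋆_) (starPow≡starPow₀ hz k)) (⋆≡⋆₀ hz (indexZero-starPow₀ hz k))

  circPowS≡circPowS₀ : ∀ {z} → IndexZeroP z → ∀ k → circPowS z k ≡ circPowS₀ z k
  circPowS≡circPowS₀ hz zero = refl
  circPowS≡circPowS₀ {z} hz (suc k) = trans (cong (z ∘_) (circPowS≡circPowS₀ hz k)) (∘≡∘₀ hz (indexZero-circPowS₀ hz k))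

  Σ≤-cong-≡ : ∀ m {f g} → (∀ k → f k ≡ g k) → Σ≤ m f ≡ Σ≤ m g
  Σ≤-cong-≡ zero h = h 0
  Σ≤-cong-≡ (suc m) h = cong₂ _⊕_ (Σ≤-cong-≡ m h) (h (suc m))

  exp⋆≡exp⋆₀ : ∀ m {z} → IndexZeroP z → exp⋆ m z ≡ exp⋆₀ m z
  exp⋆≡exp⋆₀ m hz = Σ≤-cong-≡ m (λ k → cong (scale (invFact k)) (starPow≡starPow₀ hz k))

  exp∘∘≡exp∘∘₀ : ∀ m {z z′} → IndexZeroP z → IndexZeroP z′ → exp∘∘ m z z′ ≡ exp∘∘₀ m z z′
  exp∘∘≡exp∘∘₀ m {z} {z′} hz hz′ = cong (z′ ⊕_) (Σ≤-cong-≡ m (λ k → cong (scale (invFact (suc k)))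
    (trans (cong (_∘ z′) (circPowS≡circPowS₀ hz k)) (∘≡∘₀ (indexZero-circPowS₀ hz k) hz′))))

  δ-toAbsoluteP : ∀ {z} w → IndexZeroP z → δ z (toAbsoluteP w) ≡ toAbsoluteP (δ₀ z w)
  δ-toAbsoluteP {z} w hz = trans
    (cong₂ _⊖_ (trans (cong (_⋆ toAbsoluteP w) (sym (toAbsoluteP-indexZero hz))) (toAbsoluteP-⋆₀ z w))
    (·-toAbsoluteP w hz)) (sym (toAbsoluteP-⊖ _ (z · w)))

  δ^-toAbsoluteP : ∀ k {z} w → IndexZeroP z → δ^ k z (toAbsoluteP w) ≡ toAbsoluteP (δ₀^ k z w)
  δ^-toAbsoluteP zero w hz = refl
  δ^-toAbsoluteP (suc k) {z} w hz = trans (cong (δ z) (δ^-toAbsoluteP k w hz)) (δ-toAbsoluteP _ hz)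

  toAbsoluteP-Σ≤ : ∀ m f → toAbsoluteP (Σ≤ m f) ≡ Σ≤ m (λ k → toAbsoluteP (f k))
  toAbsoluteP-Σ≤ zero f = refl
  toAbsoluteP-Σ≤ (suc m) f = trans (toAbsoluteP-⊕ (Σ≤ m f) _) (cong (_⊕ toAbsoluteP (f (suc m))) (toAbsoluteP-Σ≤ m f))

  expδ-toAbsoluteP : ∀ m {z} w → IndexZeroP z → expδ m z (toAbsoluteP w) ≡ toAbsoluteP (expδ₀ m z w)
  expδ-toAbsoluteP m {z} w hz = trans (Σ≤-cong-≡ m (λ k → trans (cong (scale (invFact k)) (δ^-toAbsoluteP k w hz))
    (sym (toAbsoluteP-scale (invFact k) (δ₀^ k z w))))) (sym (toAbsoluteP-Σ≤ m _))

  ⋆₀≈bilinear : ∀ p q → p ⋆₀ q ≈ bilinear quasiShuffle p q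
  ⋆₀≈bilinear [] q = ≈-refl
  ⋆₀≈bilinear ((c , u) ∷ p) q = ⊕-cong (row q) (⋆₀≈bilinear p q)
    where
      row : ∀ q → concatMap (λ { (d , v) → scale (c * d) (quasiShuffle u v) }) q ≈ scale c (extend (quasiShuffle u) q)
      row [] = ≈-refl
      row ((d , v) ∷ q) = ≈-trans (⊕-cong (≈-sym (scale-* c d (quasiShuffle u v))) (row q))
        (≡⇒≈ (sym (scale-⊕ c (scale d (quasiShuffle u v)) _)))

  ⋆₀-isBilinear : IsBilinear _⋆₀_
  ⋆₀-isBilinear = isBilinear-resp {b = quasiShuffle} ⋆₀≈bilinear

  ⋆₀-linearˡ : ∀ q → IsLinear (_⋆₀ q)
  ⋆₀-linearˡ = IsBilinear.linearˡ ⋆₀-isBilinear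

  ⋆₀-linearʳ : ∀ p → IsLinear (p ⋆₀_)
  ⋆₀-linearʳ = IsBilinear.linearʳ ⋆₀-isBilinear

  open IsBilinear ⋆₀-isBilinear using () renaming (∙-cong to ⋆₀-cong; ∙-congˡ to ⋆₀-congˡ; ∙-congʳ to ⋆₀-congʳ)

  ⋆₀-word : ∀ u v → word u ⋆₀ word v ≈ quasiShuffle u v
  ⋆₀-word u v = ≈-trans (⋆₀≈bilinear (word u) (word v)) (bilinear-word quasiShuffle u v)

  ⋆₀-identityˡ : ∀ p → 𝟙 ⋆₀ p ≈ p
  ⋆₀-identityˡ = linear-≈ (⋆₀-linearʳ 𝟙) id-linear (⋆₀-word [])

  ⋆₀-identityʳ : ∀ p → p ⋆₀ 𝟙 ≈ p
  ⋆₀-identityʳ = linear-≈ (⋆₀-linearˡ 𝟙) id-linear (λ u → ≈-trans (⋆₀-word u []) (≡⇒≈ (quasiShuffle-[]ʳ u)))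
    where
      quasiShuffle-[]ʳ : ∀ u → quasiShuffle u [] ≡ word u
      quasiShuffle-[]ʳ [] = refl
      quasiShuffle-[]ʳ (_ ∷ _) = refl

  ⋆₀-prefix-prefix : ∀ x v p q → prefix x p ⋆₀ prefix v q ≈
    prefix x (p ⋆₀ prefix v q) ⊕ prefix v (prefix x p ⋆₀ q) ⊕ prefix (merge x v) (p ⋆₀ q)
  ⋆₀-prefix-prefix x v = bilinear-≈
    {F = λ p q → prefix x p ⋆₀ prefix v q}
    {G = λ p q → prefix x (p ⋆₀ prefix v q) ⊕ prefix v (prefix x p ⋆₀ q) ⊕ prefix (merge x v) (p ⋆₀ q)}
    (record { linearˡ = λ q → ∘-linear (⋆₀-linearˡ (prefix v q)) (prefix-linear x)
            ; linearʳ = λ p → ∘-linear (⋆₀-linearʳ (prefix x p)) (prefix-linear v) })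
    (record { linearˡ = λ q → ⊕-linear (⊕-linear (∘-linear (prefix-linear x) (⋆₀-linearˡ (prefix v q)))
                                                  (∘-linear (prefix-linear v) (∘-linear (⋆₀-linearˡ q) (prefix-linear x))))
                                        (∘-linear (prefix-linear (merge x v)) (⋆₀-linearˡ q))
            ; linearʳ = λ p → ⊕-linear (⊕-linear (∘-linear (prefix-linear x) (∘-linear (⋆₀-linearʳ p) (prefix-linear v)))
                                                  (∘-linear (prefix-linear v) (⋆₀-linearʳ (prefix x p))))
                                        (∘-linear (prefix-linear (merge x v)) (⋆₀-linearʳ p)) })
    (λ a b → ≈-trans (⋆₀-word (x ∷ a) (v ∷ b)) (≈-sym (⊕-cong (⊕-cong
      (prefix-cong x (⋆₀-word a (v ∷ b))) (prefix-cong v (⋆₀-word (x ∷ a) b))) (prefix-cong (merge x v) (⋆₀-word a b)))))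

  merge-assoc : ∀ x v w → merge (merge x v) w ≡ merge x (merge v w)
  merge-assoc (y a i) (y b j) (y c k) = cong₂ y
    (cong suc (trans (cong suc (ℕP.+-assoc a b c)) (sym (ℕP.+-suc a (b ℕ.+ c)))))
    (trans (fin-toℕ-fin-+ (toℕ i ℕ.+ toℕ j) (toℕ k))
      (trans (cong fin (ℕP.+-assoc (toℕ i) (toℕ j) (toℕ k))) (sym (fin-+-toℕ-fin (toℕ i) (toℕ j ℕ.+ toℕ k)))))

  sevenTerms : (Poly → Poly → Poly → Poly) → Y → Y → Y → Poly → Poly → Poly → Poly
  sevenTerms G x v w p q r =
      prefix x (G p (prefix v q) (prefix w r)) ⊕ prefix v (G (prefix x p) q (prefix w r))
    ⊕ prefix (merge x v) (G p q (prefix w r)) ⊕ prefix w (G (prefix x p) (prefix v q) r)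
    ⊕ prefix (merge x w) (G p (prefix v q) r) ⊕ prefix (merge v w) (G (prefix x p) q r)
    ⊕ prefix (merge (merge x v) w) (G p q r)

  ⋆₀-assocˡ-expand : ∀ x v w p q r →
    (prefix x p ⋆₀ prefix v q) ⋆₀ prefix w r ≈ sevenTerms (λ p q r → (p ⋆₀ q) ⋆₀ r) x v w p q r
  ⋆₀-assocˡ-expand x v w p q r = begin
      (prefix x p ⋆₀ prefix v q) ⋆₀ prefix w r
    ≈⟨ ⋆₀-congʳ (prefix w r) (⋆₀-prefix-prefix x v p q) ⟩
      (X ⊕ V ⊕ M) ⋆₀ prefix w r
    ≈⟨ IsLinear.⊕₃-homo (⋆₀-linearˡ (prefix w r)) X V M ⟩
      (X ⋆₀ prefix w r) ⊕ (V ⋆₀ prefix w r) ⊕ (M ⋆₀ prefix w r)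
    ≈⟨ ⊕-cong (⊕-cong (⋆₀-prefix-prefix x w (p ⋆₀ prefix v q) r) (⋆₀-prefix-prefix v w (prefix x p ⋆₀ q) r))
              (⋆₀-prefix-prefix (merge x v) w (p ⋆₀ q) r) ⟩
      (x₁ ⊕ w₁ ⊕ m₁) ⊕ (v₂ ⊕ w₂ ⊕ m₂) ⊕ (xv₃ ⊕ w₃ ⊕ m₃)
    ≈⟨ ⊕-solve 9 (λ x₁ w₁ m₁ v₂ w₂ m₂ xv₃ w₃ m₃ →
                     (x₁ ⊞ w₁ ⊞ m₁) ⊞ (v₂ ⊞ w₂ ⊞ m₂) ⊞ (xv₃ ⊞ w₃ ⊞ m₃)
                   ⊜ x₁ ⊞ v₂ ⊞ xv₃ ⊞ (w₁ ⊞ w₂ ⊞ w₃) ⊞ m₁ ⊞ m₂ ⊞ m₃)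
         ≈-refl x₁ w₁ m₁ v₂ w₂ m₂ xv₃ w₃ m₃ ⟩
      x₁ ⊕ v₂ ⊕ xv₃ ⊕ (w₁ ⊕ w₂ ⊕ w₃) ⊕ m₁ ⊕ m₂ ⊕ m₃
    ≈⟨ ⊕-congʳ m₃ (⊕-congʳ m₂ (⊕-congʳ m₁ (⊕-congˡ (x₁ ⊕ v₂ ⊕ xv₃) w-terms))) ⟩
      sevenTerms (λ p q r → (p ⋆₀ q) ⋆₀ r) x v w p q r
    ∎
    where
      open ≈-Reasoning
      X = prefix x (p ⋆₀ prefix v q)
      V = prefix v (prefix x p ⋆₀ q)
      M = prefix (merge x v) (p ⋆₀ q)
      x₁ = prefix x ((p ⋆₀ prefix v q) ⋆₀ prefix w r)
      w₁ = prefix w (X ⋆₀ r)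
      m₁ = prefix (merge x w) ((p ⋆₀ prefix v q) ⋆₀ r)
      v₂ = prefix v ((prefix x p ⋆₀ q) ⋆₀ prefix w r)
      w₂ = prefix w (V ⋆₀ r)
      m₂ = prefix (merge v w) ((prefix x p ⋆₀ q) ⋆₀ r)
      xv₃ = prefix (merge x v) ((p ⋆₀ q) ⋆₀ prefix w r)
      w₃ = prefix w (M ⋆₀ r)
      m₃ = prefix (merge (merge x v) w) ((p ⋆₀ q) ⋆₀ r)
      w-terms : w₁ ⊕ w₂ ⊕ w₃ ≈ prefix w ((prefix x p ⋆₀ prefix v q) ⋆₀ r)
      w-terms = begin
          w₁ ⊕ w₂ ⊕ w₃
        ≡⟨ trans (cong (_⊕ w₃) (sym (prefix-⊕ w (X ⋆₀ r) (V ⋆₀ r)))) (sym (prefix-⊕ w _ (M ⋆₀ r))) ⟩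
          prefix w ((X ⋆₀ r) ⊕ (V ⋆₀ r) ⊕ (M ⋆₀ r))
        ≈⟨ prefix-cong w (IsLinear.⊕₃-homo (⋆₀-linearˡ r) X V M) ⟨
          prefix w ((X ⊕ V ⊕ M) ⋆₀ r)
        ≈⟨ prefix-cong w (⋆₀-congʳ r (⋆₀-prefix-prefix x v p q)) ⟨
          prefix w ((prefix x p ⋆₀ prefix v q) ⋆₀ r)
        ∎

  ⋆₀-assocʳ-expand : ∀ x v w p q r →
    prefix x p ⋆₀ (prefix v q ⋆₀ prefix w r) ≈ sevenTerms (λ p q r → p ⋆₀ (q ⋆₀ r)) x v w p q r
  ⋆₀-assocʳ-expand x v w p q r = begin
      prefix x p ⋆₀ (prefix v q ⋆₀ prefix w r)
    ≈⟨ ⋆₀-congˡ (prefix x p) (⋆₀-prefix-prefix v w q r) ⟩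
      prefix x p ⋆₀ (V ⊕ W ⊕ M)
    ≈⟨ IsLinear.⊕₃-homo (⋆₀-linearʳ (prefix x p)) V W M ⟩
      (prefix x p ⋆₀ V) ⊕ (prefix x p ⋆₀ W) ⊕ (prefix x p ⋆₀ M)
    ≈⟨ ⊕-cong (⊕-cong (⋆₀-prefix-prefix x v p (q ⋆₀ prefix w r)) (⋆₀-prefix-prefix x w p (prefix v q ⋆₀ r)))
              (⋆₀-prefix-prefix x (merge v w) p (q ⋆₀ r)) ⟩
      (x₁ ⊕ v₁ ⊕ xv₁) ⊕ (x₂ ⊕ w₂ ⊕ xw₂) ⊕ (x₃ ⊕ vw₃ ⊕ m₃)
    ≈⟨ ⊕-solve 9 (λ x₁ v₁ xv₁ x₂ w₂ xw₂ x₃ vw₃ m₃ →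
                     (x₁ ⊞ v₁ ⊞ xv₁) ⊞ (x₂ ⊞ w₂ ⊞ xw₂) ⊞ (x₃ ⊞ vw₃ ⊞ m₃)
                   ⊜ (x₁ ⊞ x₂ ⊞ x₃) ⊞ v₁ ⊞ xv₁ ⊞ w₂ ⊞ xw₂ ⊞ vw₃ ⊞ m₃)
         ≈-refl x₁ v₁ xv₁ x₂ w₂ xw₂ x₃ vw₃ m₃ ⟩
      (x₁ ⊕ x₂ ⊕ x₃) ⊕ v₁ ⊕ xv₁ ⊕ w₂ ⊕ xw₂ ⊕ vw₃ ⊕ m₃
    ≈⟨ ⊕-cong (⊕-congʳ vw₃ (⊕-congʳ xw₂ (⊕-congʳ w₂ (⊕-congʳ xv₁ (⊕-congʳ v₁ x-terms)))))
              (≡⇒≈ (cong (λ l → prefix l (p ⋆₀ (q ⋆₀ r))) (sym (merge-assoc x v w)))) ⟩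
      sevenTerms (λ p q r → p ⋆₀ (q ⋆₀ r)) x v w p q r
    ∎
    where
      open ≈-Reasoning
      V = prefix v (q ⋆₀ prefix w r)
      W = prefix w (prefix v q ⋆₀ r)
      M = prefix (merge v w) (q ⋆₀ r)
      x₁ = prefix x (p ⋆₀ V)
      v₁ = prefix v (prefix x p ⋆₀ (q ⋆₀ prefix w r))
      xv₁ = prefix (merge x v) (p ⋆₀ (q ⋆₀ prefix w r))
      x₂ = prefix x (p ⋆₀ W)
      w₂ = prefix w (prefix x p ⋆₀ (prefix v q ⋆₀ r))
      xw₂ = prefix (merge x w) (p ⋆₀ (prefix v q ⋆₀ r))
      x₃ = prefix x (p ⋆₀ M)
      vw₃ = prefix (merge v w) (prefix x p ⋆₀ (q ⋆₀ r))
      m₃ = prefix (merge x (merge v w)) (p ⋆₀ (q ⋆₀ r))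
      x-terms : x₁ ⊕ x₂ ⊕ x₃ ≈ prefix x (p ⋆₀ (prefix v q ⋆₀ prefix w r))
      x-terms = begin
          x₁ ⊕ x₂ ⊕ x₃
        ≡⟨ trans (cong (_⊕ x₃) (sym (prefix-⊕ x (p ⋆₀ V) (p ⋆₀ W)))) (sym (prefix-⊕ x _ (p ⋆₀ M))) ⟩
          prefix x ((p ⋆₀ V) ⊕ (p ⋆₀ W) ⊕ (p ⋆₀ M))
        ≈⟨ prefix-cong x (IsLinear.⊕₃-homo (⋆₀-linearʳ p) V W M) ⟨
          prefix x (p ⋆₀ (V ⊕ W ⊕ M))
        ≈⟨ prefix-cong x (⋆₀-congˡ p (⋆₀-prefix-prefix v w q r)) ⟨
          prefix x (p ⋆₀ (prefix v q ⋆₀ prefix w r))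
        ∎

  ⋆₀-assoc-words : ∀ a b c → (word a ⋆₀ word b) ⋆₀ word c ≈ word a ⋆₀ (word b ⋆₀ word c)
  ⋆₀-assoc-words [] b c =
    ≈-trans (⋆₀-congʳ (word c) (⋆₀-identityˡ (word b))) (≈-sym (⋆₀-identityˡ (word b ⋆₀ word c)))
  ⋆₀-assoc-words (x ∷ a) [] c = ≈-trans (⋆₀-congʳ (word c) (⋆₀-identityʳ (word (x ∷ a))))
    (≈-sym (⋆₀-congˡ (word (x ∷ a)) (⋆₀-identityˡ (word c))))
  ⋆₀-assoc-words (x ∷ a) (v ∷ b) [] = ≈-trans (⋆₀-identityʳ (word (x ∷ a) ⋆₀ word (v ∷ b)))
    (≈-sym (⋆₀-congˡ (word (x ∷ a)) (⋆₀-identityʳ (word (v ∷ b)))))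
  ⋆₀-assoc-words (x ∷ a) (v ∷ b) (w ∷ c) = begin
      (word (x ∷ a) ⋆₀ word (v ∷ b)) ⋆₀ word (w ∷ c)
    ≈⟨ ⋆₀-assocˡ-expand x v w (word a) (word b) (word c) ⟩
      sevenTerms (λ p q r → (p ⋆₀ q) ⋆₀ r) x v w (word a) (word b) (word c)
    ≈⟨ ⊕-cong (⊕-cong (⊕-cong (⊕-cong (⊕-cong (⊕-cong
         (prefix-cong x (⋆₀-assoc-words a (v ∷ b) (w ∷ c))) (prefix-cong v (⋆₀-assoc-words (x ∷ a) b (w ∷ c))))
         (prefix-cong (merge x v) (⋆₀-assoc-words a b (w ∷ c)))) (prefix-cong w (⋆₀-assoc-words (x ∷ a) (v ∷ b) c)))
         (prefix-cong (merge x w) (⋆₀-assoc-words a (v ∷ b) c))) (prefix-cong (merge v w) (⋆₀-assoc-words (x ∷ a) b c)))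
         (prefix-cong (merge (merge x v) w) (⋆₀-assoc-words a b c)) ⟩
      sevenTerms (λ p q r → p ⋆₀ (q ⋆₀ r)) x v w (word a) (word b) (word c)
    ≈⟨ ⋆₀-assocʳ-expand x v w (word a) (word b) (word c) ⟨
      word (x ∷ a) ⋆₀ (word (v ∷ b) ⋆₀ word (w ∷ c))
    ∎
    where open ≈-Reasoning

  ⋆₀-assoc : ∀ p q r → (p ⋆₀ q) ⋆₀ r ≈ p ⋆₀ (q ⋆₀ r)
  ⋆₀-assoc = bilinear-assoc ⋆₀-isBilinear ⋆₀-assoc-words

  -- Product rules

  letter : Y → Poly
  letter x = word (x ∷ [])

  Letters : Poly → Set
  Letters = AllWords (λ v → ∃ λ x → v ≡ x ∷ [])

  letters-toP : ∀ z → Letters (toP z)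
  letters-toP [] = []
  letters-toP ((_ , e) ∷ z) = (y e Fin.zero , refl) ∷ letters-toP z

  linear-≈-onLetters : ∀ {F G} → IsLinear F → IsLinear G → (∀ x → F (letter x) ≈ G (letter x)) →
    ∀ {p} → Letters p → F p ≈ G p
  linear-≈-onLetters LF LG h {p} hp = linear-≈-on LF LG p (All.map (λ { (x , refl) → h x }) hp)

  δ₀-linearʳ : ∀ z → IsLinear (δ₀ z)
  δ₀-linearʳ z = ⊖-linear (⋆₀-linearʳ z) (·-linearʳ z)

  δ₀-linearˡ : ∀ w → IsLinear (λ z → δ₀ z w)
  δ₀-linearˡ w = ⊖-linear (⋆₀-linearˡ w) (·-linearˡ w)

  ⋆₀≈δ₀⊕· : ∀ z w → z ⋆₀ w ≈ δ₀ z w ⊕ z · w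
  ⋆₀≈δ₀⊕· z w = ≈-sym (⊖-⊕-cancel (z ⋆₀ w) (z · w))

  ⋆₀-letter-prefix : ∀ z x p →
    letter z ⋆₀ prefix x p ≈ prefix z (prefix x p) ⊕ prefix x (letter z ⋆₀ p) ⊕ prefix (merge z x) p
  ⋆₀-letter-prefix z x p = ≈-trans (⋆₀-prefix-prefix z x 𝟙 p)
    (⊕-cong (⊕-congʳ (prefix x (letter z ⋆₀ p)) (prefix-cong z (⋆₀-identityˡ (prefix x p))))
            (prefix-cong (merge z x) (⋆₀-identityˡ p)))

  letter-⋆₀-· : ∀ z u q → letter z ⋆₀ (word u · q) ≈ (letter z ⋆₀ word u) · q ⊕ word u · δ₀ (letter z) q
  letter-⋆₀-· z [] q = begin
      Z ⋆₀ (𝟙 · q)                    ≈⟨ ⋆₀-congˡ Z (·-identityˡ q) ⟩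
      Z ⋆₀ q                          ≈⟨ ⋆₀≈δ₀⊕· Z q ⟩
      δ₀ Z q ⊕ Z · q                  ≈⟨ ⊕-comm (δ₀ Z q) (Z · q) ⟩
      Z · q ⊕ δ₀ Z q                  ≈⟨ ⊕-cong (·-congʳ q (⋆₀-identityʳ Z)) (·-identityˡ (δ₀ Z q)) ⟨
      (Z ⋆₀ 𝟙) · q ⊕ 𝟙 · δ₀ Z q        ∎
    where
      open ≈-Reasoning
      Z = letter z
  letter-⋆₀-· z (x ∷ u) q = begin
      Z ⋆₀ (word (x ∷ u) · q)
    ≡⟨ cong (Z ⋆₀_) (prefix-· x (word u) q) ⟩
      Z ⋆₀ prefix x (word u · q)
    ≈⟨ ⋆₀-letter-prefix z x (word u · q) ⟩
      prefix z (prefix x (word u · q)) ⊕ prefix x (Z ⋆₀ (word u · q)) ⊕ prefix (merge z x) (word u · q)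
    ≈⟨ ⊕-congʳ (prefix (merge z x) (word u · q)) (⊕-congˡ (prefix z (prefix x (word u · q)))
         (≈-trans (prefix-cong x (letter-⋆₀-· z u q)) (≡⇒≈ (prefix-⊕ x ((Z ⋆₀ word u) · q) (word u · δ₀ Z q))))) ⟩
      zxq ⊕ (xZq ⊕ xδ) ⊕ mq
    ≈⟨ ⊕-solve 4 (λ a b c d → a ⊞ (b ⊞ c) ⊞ d ⊜ a ⊞ b ⊞ d ⊞ c) ≈-refl zxq xZq xδ mq ⟩
      zxq ⊕ xZq ⊕ mq ⊕ xδ
    ≡⟨ sym (cong₂ _⊕_ distribute (prefix-· x (word u) (δ₀ Z q))) ⟩
      ((prefix z (word (x ∷ u)) ⊕ prefix x (Z ⋆₀ word u) ⊕ prefix (merge z x) (word u)) · q) ⊕ word (x ∷ u) · δ₀ Z q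
    ≈⟨ ⊕-congʳ (word (x ∷ u) · δ₀ Z q) (·-congʳ q (⋆₀-letter-prefix z x (word u))) ⟨
      (Z ⋆₀ word (x ∷ u)) · q ⊕ word (x ∷ u) · δ₀ Z q
    ∎
    where
      open ≈-Reasoning
      Z = letter z
      zxq = prefix z (prefix x (word u · q))
      xZq = prefix x ((Z ⋆₀ word u) · q)
      xδ = prefix x (word u · δ₀ Z q)
      mq = prefix (merge z x) (word u · q)
      distribute : (prefix z (word (x ∷ u)) ⊕ prefix x (Z ⋆₀ word u) ⊕ prefix (merge z x) (word u)) · q ≡ zxq ⊕ xZq ⊕ mq
      distribute = trans (⊕-· (prefix z (word (x ∷ u)) ⊕ prefix x (Z ⋆₀ word u)) (prefix (merge z x) (word u)) q)
        (cong₂ _⊕_ (trans (⊕-· (prefix z (word (x ∷ u))) (prefix x (Z ⋆₀ word u)) q)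
          (cong₂ _⊕_ (trans (prefix-· z (word (x ∷ u)) q) (cong (prefix z) (prefix-· x (word u) q)))
                     (prefix-· x (Z ⋆₀ word u) q)))
          (prefix-· (merge z x) (word u) q))

  ⋆₀-· : ∀ {z} → Letters z → ∀ p q → z ⋆₀ (p · q) ≈ (z ⋆₀ p) · q ⊕ p · δ₀ z q
  ⋆₀-· hz p q = linear-≈-onLetters {F = λ z → z ⋆₀ (p · q)} {G = λ z → (z ⋆₀ p) · q ⊕ p · δ₀ z q}
    (⋆₀-linearˡ (p · q)) (⊕-linear (∘-linear (·-linearˡ q) (⋆₀-linearˡ p)) (∘-linear (·-linearʳ p) (δ₀-linearˡ q)))
    (λ x → linear-≈ {F = λ p → letter x ⋆₀ (p · q)} {G = λ p → (letter x ⋆₀ p) · q ⊕ p · δ₀ (letter x) q}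
      (∘-linear (⋆₀-linearʳ (letter x)) (·-linearˡ q))
      (⊕-linear (∘-linear (·-linearˡ q) (⋆₀-linearʳ (letter x))) (·-linearˡ (δ₀ (letter x) q)))
      (λ u → letter-⋆₀-· x u q) p)
    hz

  δ₀-· : ∀ {z} → Letters z → ∀ c p → δ₀ z (c · p) ≈ (z ∘₀ c) · p ⊕ c · (z ⋆₀ p)
  δ₀-· {z} hz c p = begin
      δ₀ z (c · p)
    ≈⟨ ⊕-congʳ (scale (- 1ℚ) (z · (c · p))) (⋆₀-· hz c p) ⟩
      ((z ⋆₀ c) · p ⊕ c · δ₀ z p) ⊖ z · (c · p)
    ≈⟨ rearrange ((z ⋆₀ c) · p) (z · (c · p)) (c · (z · p)) (c · δ₀ z p) ⟨
      ((z ⋆₀ c) · p ⊖ z · (c · p) ⊖ c · (z · p)) ⊕ (c · δ₀ z p ⊕ c · (z · p))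
    ≈⟨ ⊕-cong (⊕-cong (⊕-congˡ ((z ⋆₀ c) · p) (scale-cong (- 1ℚ) (·-assoc z c p)))
                      (scale-cong (- 1ℚ) (·-assoc c z p)))
              (IsLinear.⊕-homo (·-linearʳ c) (δ₀ z p) (z · p)) ⟨
      ((z ⋆₀ c) · p ⊖ (z · c) · p ⊖ (c · z) · p) ⊕ c · (δ₀ z p ⊕ z · p)
    ≈⟨ ⊕-cong (≈-trans (IsLinear.⊖-homo (·-linearˡ p) (z ⋆₀ c ⊖ z · c) (c · z))
                 (⊕-congʳ (scale (- 1ℚ) ((c · z) · p)) (IsLinear.⊖-homo (·-linearˡ p) (z ⋆₀ c) (z · c))))
              (·-congˡ c (⋆₀≈δ₀⊕· z p)) ⟨
      ((z ∘₀ c) · p) ⊕ c · (z ⋆₀ p)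
    ∎
    where
      open ≈-Reasoning
      rearrange : ∀ a b e d → (a ⊖ b ⊖ e) ⊕ (d ⊕ e) ≈ (a ⊕ d) ⊖ b
      rearrange a b e d = begin
          a ⊖ b ⊖ e ⊕ (d ⊕ e)
        ≈⟨ ⊕-solve 5 (λ a b′ e′ d e → a ⊞ b′ ⊞ e′ ⊞ (d ⊞ e) ⊜ a ⊞ d ⊞ b′ ⊞ (e ⊞ e′))
             ≈-refl a (scale (- 1ℚ) b) (scale (- 1ℚ) e) d e ⟩
          (a ⊕ d) ⊖ b ⊕ (e ⊖ e)
        ≈⟨ ⊕-congˡ ((a ⊕ d) ⊖ b) (⊖-cancel e) ⟩
          (a ⊕ d) ⊖ b ⊕ 0P
        ≡⟨ ListP.++-identityʳ _ ⟩
          (a ⊕ d) ⊖ b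
        ∎

  ∘₀-isBilinear : IsBilinear _∘₀_
  ∘₀-isBilinear = record
    { linearˡ = λ q → ⊖-linear (⊖-linear (⋆₀-linearˡ q) (·-linearˡ q)) (·-linearʳ q)
    ; linearʳ = λ p → ⊖-linear (⊖-linear (⋆₀-linearʳ p) (·-linearʳ p)) (·-linearˡ p) }

  open IsBilinear ∘₀-isBilinear using ()
    renaming (linearˡ to ∘₀-linearˡ; linearʳ to ∘₀-linearʳ; ∙-congˡ to ∘₀-congˡ; ∙-congʳ to ∘₀-congʳ)

  letter-∘₀ : ∀ x v → letter x ∘₀ letter v ≈ letter (merge x v)
  letter-∘₀ x v = begin
      letter x ∘₀ letter v
    ≈⟨ ⊕-cong (⊕-cong (⋆₀-word (x ∷ []) (v ∷ [])) (scale-cong (- 1ℚ) (·-word (x ∷ []) (v ∷ []))))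
              (scale-cong (- 1ℚ) (·-word (v ∷ []) (x ∷ []))) ⟩
      xv ⊕ vx ⊕ m ⊖ xv ⊖ vx
    ≈⟨ ⊕-solve 5 (λ xv vx m xv′ vx′ → xv ⊞ vx ⊞ m ⊞ xv′ ⊞ vx′ ⊜ m ⊞ (xv ⊞ xv′) ⊞ (vx ⊞ vx′))
         ≈-refl xv vx m (scale (- 1ℚ) xv) (scale (- 1ℚ) vx) ⟩
      m ⊕ (xv ⊖ xv) ⊕ (vx ⊖ vx)
    ≈⟨ ⊕-cong (⊕-congˡ m (⊖-cancel xv)) (⊖-cancel vx) ⟩
      m ⊕ 0P ⊕ 0P
    ≡⟨ trans (ListP.++-identityʳ _) (ListP.++-identityʳ m) ⟩
      m
    ∎
    where
      open ≈-Reasoning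
      xv = word (x ∷ v ∷ [])
      vx = word (v ∷ x ∷ [])
      m = letter (merge x v)

  ∘₀-assoc : ∀ {p q r} → Letters p → Letters q → Letters r → (p ∘₀ q) ∘₀ r ≈ p ∘₀ (q ∘₀ r)
  ∘₀-assoc {p} {q} {r} hp hq hr = bilinear-≈-on {F = λ p q → (p ∘₀ q) ∘₀ r} {G = λ p q → p ∘₀ (q ∘₀ r)}
    (record { linearˡ = λ q → ∘-linear (∘₀-linearˡ r) (∘₀-linearˡ q)
            ; linearʳ = λ p → ∘-linear (∘₀-linearˡ r) (∘₀-linearʳ p) })
    (record { linearˡ = λ q → ∘₀-linearˡ (q ∘₀ r) ; linearʳ = λ p → ∘-linear (∘₀-linearʳ p) (∘₀-linearˡ r) })
    (λ { _ _ (x , refl) (v , refl) → linear-≈-onLetters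
      {F = λ r → (letter x ∘₀ letter v) ∘₀ r} {G = λ r → letter x ∘₀ (letter v ∘₀ r)}
      (∘₀-linearʳ (letter x ∘₀ letter v)) (∘-linear (∘₀-linearʳ (letter x)) (∘₀-linearʳ (letter v)))
      (λ w → begin
        (letter x ∘₀ letter v) ∘₀ letter w   ≈⟨ ∘₀-congʳ (letter w) (letter-∘₀ x v) ⟩
        letter (merge x v) ∘₀ letter w       ≈⟨ letter-∘₀ (merge x v) w ⟩
        letter (merge (merge x v) w)         ≡⟨ cong letter (merge-assoc x v w) ⟩
        letter (merge x (merge v w))         ≈⟨ letter-∘₀ x (merge v w) ⟨
        letter x ∘₀ letter (merge v w)       ≈⟨ ∘₀-congˡ (letter x) (letter-∘₀ v w) ⟨
        letter x ∘₀ (letter v ∘₀ letter w)   ∎) hr })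
    p q hp hq
    where open ≈-Reasoning

  -- Only the values on pairs of single letters matter.
  mergeLetters : Word → Word → Poly
  mergeLetters (x ∷ _) (v ∷ _) = letter (merge x v)
  mergeLetters _ _ = 0P

  ∘₀≈bilinear-mergeLetters : ∀ {p q} → Letters p → Letters q → p ∘₀ q ≈ bilinear mergeLetters p q
  ∘₀≈bilinear-mergeLetters {p} {q} = bilinear-≈-on ∘₀-isBilinear (bilinear-isBilinear mergeLetters)
    (λ { _ _ (x , refl) (v , refl) → ≈-trans (letter-∘₀ x v) (≈-sym (bilinear-word mergeLetters (x ∷ []) (v ∷ []))) }) p q

  letters-bilinear-mergeLetters : ∀ p q → Letters (bilinear mergeLetters p q)
  letters-bilinear-mergeLetters p q = AllWords-extend (λ u → AllWords-extend (letters-mergeLetters u) q) p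
    where
      letters-mergeLetters : ∀ u v → Letters (mergeLetters u v)
      letters-mergeLetters (x ∷ _) (v ∷ _) = (merge x v , refl) ∷ []
      letters-mergeLetters [] _ = []
      letters-mergeLetters (_ ∷ _) [] = []

  circPowS₀≈letters : ∀ {z} → Letters z → ∀ k → ∃ λ l → Letters l × circPowS₀ z k ≈ l
  circPowS₀≈letters {z} hz zero = z , hz , ≈-refl
  circPowS₀≈letters {z} hz (suc k) with circPowS₀≈letters hz k
  ... | l , hl , e = bilinear mergeLetters z l , letters-bilinear-mergeLetters z l ,
    ≈-trans (∘₀-congˡ z e) (∘₀≈bilinear-mergeLetters hz hl)

  circPowS₀-suc-∘₀ : ∀ {z z′} → Letters z → Letters z′ →
    ∀ k → circPowS₀ z (suc k) ∘₀ z′ ≈ z ∘₀ (circPowS₀ z k ∘₀ z′)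
  circPowS₀-suc-∘₀ {z} {z′} hz hz′ k with circPowS₀≈letters hz k
  ... | l , hl , e = begin
      (z ∘₀ circPowS₀ z k) ∘₀ z′   ≈⟨ ∘₀-congʳ z′ (∘₀-congˡ z e) ⟩
      (z ∘₀ l) ∘₀ z′               ≈⟨ ∘₀-assoc hz hl hz′ ⟩
      z ∘₀ (l ∘₀ z′)               ≈⟨ ∘₀-congˡ z (∘₀-congʳ z′ e) ⟨
      z ∘₀ (circPowS₀ z k ∘₀ z′)   ∎
    where open ≈-Reasoning

  -- Iterates of an operator obeying a Leibniz rule

  diag : (ℕ → ℕ → Poly) → ℕ → Poly
  diag F zero = F 0 0
  diag F (suc k) = F 0 (suc k) ⊕ diag (λ a b → F (suc a) b) k

  diag-cong : ∀ k {F G} → (∀ a b → a ℕ.+ b ≡ k → F a b ≈ G a b) → diag F k ≈ diag G k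
  diag-cong zero h = h 0 0 refl
  diag-cong (suc k) h = ⊕-cong (h 0 (suc k) refl) (diag-cong k (λ a b e → h (suc a) b (cong suc e)))

  diag-linear : ∀ {D} → IsLinear D → ∀ k F → D (diag F k) ≈ diag (λ a b → D (F a b)) k
  diag-linear L zero F = ≈-refl
  diag-linear L (suc k) F = ≈-trans (IsLinear.⊕-homo L _ _) (⊕-congˡ _ (diag-linear L k (λ a b → F (suc a) b)))

  diag-⊕ : ∀ k F G → diag (λ a b → F a b ⊕ G a b) k ≈ diag F k ⊕ diag G k
  diag-⊕ zero F G = ≈-refl
  diag-⊕ (suc k) F G = ≈-trans (⊕-congˡ (F 0 (suc k) ⊕ G 0 (suc k)) (diag-⊕ k (λ a b → F (suc a) b) (λ a b → G (suc a) b)))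
    (⊕-interchange (F 0 (suc k)) (G 0 (suc k)) (diag (λ a b → F (suc a) b) k) (diag (λ a b → G (suc a) b) k))

  diag-suc-last : ∀ k F → diag (λ a b → F a (suc b)) k ⊕ F (suc k) 0 ≈ diag F (suc k)
  diag-suc-last zero F = ≈-refl
  diag-suc-last (suc k) F = ≈-trans (≡⇒≈ (ListP.++-assoc (F 0 (suc (suc k))) _ _))
    (⊕-congˡ (F 0 (suc (suc k))) (diag-suc-last k (λ a b → F (suc a) b)))

  diag-leibniz : ∀ {D} → IsLinear D → ∀ F →
    (∀ a b → D (F a b) ≈ scale (fromℕ (suc a)) (F (suc a) b) ⊕ scale (fromℕ (suc b)) (F a (suc b))) →
    ∀ k → D (diag F k) ≈ scale (fromℕ (suc k)) (diag F (suc k))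
  diag-leibniz {D} L F h k = begin
      D (diag F k)
    ≈⟨ ≈-trans (diag-linear L k F) (diag-cong k (λ a b _ → h a b)) ⟩
      diag (λ a b → Fa (suc a) b ⊕ Fb a (suc b)) k
    ≈⟨ diag-⊕ k _ _ ⟩
      diag (λ a b → Fa (suc a) b) k ⊕ diag (λ a b → Fb a (suc b)) k
    ≈⟨ add-zeros ⟨
      (Fa 0 (suc k) ⊕ diag (λ a b → Fa (suc a) b) k) ⊕ (diag (λ a b → Fb a (suc b)) k ⊕ Fb (suc k) 0)
    ≈⟨ ⊕-congˡ (diag Fa (suc k)) (diag-suc-last k Fb) ⟩
      diag Fa (suc k) ⊕ diag Fb (suc k)
    ≈⟨ diag-⊕ (suc k) Fa Fb ⟨
      diag (λ a b → Fa a b ⊕ Fb a b) (suc k)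
    ≈⟨ diag-cong (suc k) (λ a b a+b≡k → ≈-trans (≈-sym (scale-+ (fromℕ a) (fromℕ b) (F a b)))
         (≡⇒≈ (cong (λ r → scale r (F a b)) (trans (sym (fromℕ-+ a b)) (cong fromℕ a+b≡k))))) ⟩
      diag (λ a b → scale (fromℕ (suc k)) (F a b)) (suc k)
    ≈⟨ diag-linear (scale-linear (fromℕ (suc k)) id-linear) (suc k) F ⟨
      scale (fromℕ (suc k)) (diag F (suc k))
    ∎
    where
      open ≈-Reasoning
      Fa Fb : ℕ → ℕ → Poly
      Fa a b = scale (fromℕ a) (F a b)
      Fb a b = scale (fromℕ b) (F a b)
      add-zeros : (Fa 0 (suc k) ⊕ diag (λ a b → Fa (suc a) b) k) ⊕ (diag (λ a b → Fb a (suc b)) k ⊕ Fb (suc k) 0)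
                ≈ diag (λ a b → Fa (suc a) b) k ⊕ diag (λ a b → Fb a (suc b)) k
      add-zeros = ≈-trans (⊕-cong (⊕-congʳ (diag (λ a b → Fa (suc a) b) k) (scale-0 (F 0 (suc k))))
                                  (⊕-congˡ (diag (λ a b → Fb a (suc b)) k) (scale-0 (F (suc k) 0))))
                          (≡⇒≈ (cong (diag (λ a b → Fa (suc a) b) k ⊕_) (ListP.++-identityʳ _)))

  linear-scale-invFact : ∀ {D} → IsLinear D → ∀ k p →
    D (scale (invFact k) p) ≈ scale (fromℕ (suc k)) (scale (invFact (suc k)) (D p))
  linear-scale-invFact {D} L k p = begin
    D (scale (invFact k) p)                                ≈⟨ IsLinear.scale-homo L (invFact k) p ⟩
    scale (invFact k) (D p)                                ≡⟨ cong (λ r → scale r (D p)) (fromℕ-suc-*-invFact-suc k) ⟨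
    scale (fromℕ (suc k) * invFact (suc k)) (D p)          ≈⟨ scale-* (fromℕ (suc k)) (invFact (suc k)) (D p) ⟨
    scale (fromℕ (suc k)) (scale (invFact (suc k)) (D p))  ∎
    where open ≈-Reasoning

  iterate≈diag : ∀ {D} → IsLinear D → ∀ (X : ℕ → Poly) F → X 0 ≈ F 0 0 → (∀ k → X (suc k) ≈ D (X k)) →
    (∀ a b → D (F a b) ≈ scale (fromℕ (suc a)) (F (suc a) b) ⊕ scale (fromℕ (suc b)) (F a (suc b))) →
    ∀ k → scale (invFact k) (X k) ≈ diag F k
  iterate≈diag {D} L X F X₀ Xₛ leibniz k = begin
      scale (invFact k) (X k)                          ≈⟨ scale-cong (invFact k) (X≈k!diag k) ⟩
      scale (invFact k) (scale (fromℕ (k !)) (diag F k)) ≈⟨ scale-* (invFact k) (fromℕ (k !)) (diag F k) ⟩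
      scale (invFact k * fromℕ (k !)) (diag F k)       ≡⟨ cong (λ r → scale r (diag F k)) (invFact-*-fromℕ-! k) ⟩
      scale 1ℚ (diag F k)                              ≈⟨ scale-1 (diag F k) ⟩
      diag F k                                         ∎
    where
      open ≈-Reasoning
      X≈k!diag : ∀ k → X k ≈ scale (fromℕ (k !)) (diag F k)
      X≈k!diag zero =
        ≈-trans X₀ (≈-sym (≈-trans (≡⇒≈ (cong (λ r → scale r (F 0 0)) (ℚP.+-identityʳ 1ℚ))) (scale-1 (F 0 0))))
      X≈k!diag (suc k) = begin
          X (suc k)
        ≈⟨ Xₛ k ⟩
          D (X k)
        ≈⟨ IsLinear.≈-cong L (X≈k!diag k) ⟩
          D (scale (fromℕ (k !)) (diag F k))
        ≈⟨ IsLinear.scale-homo L (fromℕ (k !)) (diag F k) ⟩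
          scale (fromℕ (k !)) (D (diag F k))
        ≈⟨ scale-cong (fromℕ (k !)) (diag-leibniz L F leibniz k) ⟩
          scale (fromℕ (k !)) (scale (fromℕ (suc k)) (diag F (suc k)))
        ≈⟨ scale-* (fromℕ (k !)) (fromℕ (suc k)) (diag F (suc k)) ⟩
          scale (fromℕ (k !) * fromℕ (suc k)) (diag F (suc k))
        ≡⟨ cong (λ r → scale r (diag F (suc k))) (trans (ℚP.*-comm (fromℕ (k !)) (fromℕ (suc k))) (sym (fromℕ-* (suc k) (k !)))) ⟩
          scale (fromℕ (suc k !)) (diag F (suc k))
        ∎

  expTerm : (ℕ → Poly) → ℕ → Poly
  expTerm α a = scale (invFact a) (α a)

  expTerm-shift : ∀ {D} → IsLinear D → ∀ α → (∀ a → D (α a) ≈ α (suc a)) →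
    ∀ a → D (expTerm α a) ≈ scale (fromℕ (suc a)) (expTerm α (suc a))
  expTerm-shift L α shift a =
    ≈-trans (linear-scale-invFact L a (α a)) (scale-cong (fromℕ (suc a)) (scale-cong (invFact (suc a)) (shift a)))

  -- Summed over k: exp(D) (α 0 · β 0) is the product of the exponential series of α and β.
  iterate≈diag-product : ∀ {D D₁ D₂} → IsLinear D → IsLinear D₁ → IsLinear D₂ →
    (∀ p q → D (p · q) ≈ D₁ p · q ⊕ p · D₂ q) →
    ∀ (α β X : ℕ → Poly) → (∀ a → D₁ (α a) ≈ α (suc a)) → (∀ b → D₂ (β b) ≈ β (suc b)) →
    X 0 ≈ α 0 · β 0 → (∀ k → X (suc k) ≈ D (X k)) →
    ∀ k → scale (invFact k) (X k) ≈ diag (λ a b → expTerm α a · expTerm β b) k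
  iterate≈diag-product {D} {D₁} {D₂} L L₁ L₂ product-rule α β X α-shift β-shift X₀ Xₛ =
    iterate≈diag L X _ (≈-trans X₀ (≈-sym (·-cong (scale-1 (α 0)) (scale-1 (β 0))))) Xₛ leibniz
    where
      leibniz : ∀ a b → D (expTerm α a · expTerm β b) ≈
        scale (fromℕ (suc a)) (expTerm α (suc a) · expTerm β b) ⊕ scale (fromℕ (suc b)) (expTerm α a · expTerm β (suc b))
      leibniz a b = ≈-trans (product-rule (expTerm α a) (expTerm β b)) (⊕-cong
        (≈-trans (·-congʳ (expTerm β b) (expTerm-shift L₁ α α-shift a))
                 (IsLinear.scale-homo (·-linearˡ (expTerm β b)) (fromℕ (suc a)) (expTerm α (suc a))))
        (≈-trans (·-congˡ (expTerm α a) (expTerm-shift L₂ β β-shift b))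
                 (IsLinear.scale-homo (·-linearʳ (expTerm α a)) (fromℕ (suc b)) (expTerm β (suc b)))))

  -- Weights and truncated equality

  WeightAtLeast : ℕ → Poly → Set
  WeightAtLeast k = AllWords (λ v → k ≤ wt v)

  weightAtLeast-0 : ∀ p → WeightAtLeast 0 p
  weightAtLeast-0 = allWords (λ _ → z≤n)

  weightAtLeast-mono : ∀ {k k′ p} → k ≤ k′ → WeightAtLeast k′ p → WeightAtLeast k p
  weightAtLeast-mono k≤k′ = All.map (ℕP.≤-trans k≤k′)

  coeff-weightAtLeast : ∀ {m p} → WeightAtLeast (suc m) p → ∀ u → wt u ≤ m → coeff p u ≡ 0ℚ
  coeff-weightAtLeast [] u _ = refl
  coeff-weightAtLeast {p = (c , v) ∷ p} (h ∷ hs) u wt-u≤m with v ≟W u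
  ... | yes refl = ⊥-elim (ℕP.<⇒≱ (ℕP.<-≤-trans (s≤s wt-u≤m) h) ℕP.≤-refl)
  ... | no _ = coeff-weightAtLeast hs u wt-u≤m

  wt-++ : ∀ u v → wt (u ++ v) ≡ wt u ℕ.+ wt v
  wt-++ [] v = refl
  wt-++ (y e i ∷ u) v = trans (cong (suc e ℕ.+_) (wt-++ u v)) (sym (ℕP.+-assoc (suc e) (wt u) (wt v)))

  weightAtLeast-· : ∀ {a b p q} → WeightAtLeast a p → WeightAtLeast b q → WeightAtLeast (a ℕ.+ b) (p · q)
  weightAtLeast-· = AllWords-·
    (λ {u} {v} a≤u b≤v → ℕP.≤-trans (ℕP.+-mono-≤ a≤u b≤v) (ℕP.≤-reflexive (sym (wt-++ u v))))

  weightAtLeast-prefix : ∀ {k e i p} → WeightAtLeast k p → WeightAtLeast (suc e ℕ.+ k) (prefix (y e i) p)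
  weightAtLeast-prefix {e = e} = AllWords-prefix (ℕP.+-monoʳ-≤ (suc e))

  quasiShuffle-weight : ∀ u v → WeightAtLeast (wt u ℕ.+ wt v) (quasiShuffle u v)
  quasiShuffle-weight [] v = ℕP.≤-refl ∷ []
  quasiShuffle-weight (x ∷ u) [] = ℕP.≤-reflexive (ℕP.+-identityʳ _) ∷ []
  quasiShuffle-weight (y s j ∷ u) (y t k ∷ v) = AllWords-⊕ (AllWords-⊕
      (weightAtLeast-mono (ℕP.≤-reflexive (ℕP.+-assoc (suc s) (wt u) _)) (weightAtLeast-prefix (quasiShuffle-weight u (y t k ∷ v))))
      (weightAtLeast-mono (ℕP.≤-reflexive (swap s t (wt u) (wt v))) (weightAtLeast-prefix (quasiShuffle-weight (y s j ∷ u) v))))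
      (weightAtLeast-mono (ℕP.≤-reflexive (merged s t (wt u) (wt v))) (weightAtLeast-prefix (quasiShuffle-weight u v)))
    where
      swap : ∀ s t a b → suc s ℕ.+ a ℕ.+ (suc t ℕ.+ b) ≡ suc t ℕ.+ (suc s ℕ.+ a ℕ.+ b)
      swap = solve-∀
      merged : ∀ s t a b → suc s ℕ.+ a ℕ.+ (suc t ℕ.+ b) ≡ suc (suc (s ℕ.+ t)) ℕ.+ (a ℕ.+ b)
      merged = solve-∀

  weightAtLeast-⋆₀ : ∀ {a b p q} → WeightAtLeast a p → WeightAtLeast b q → WeightAtLeast (a ℕ.+ b) (p ⋆₀ q)
  weightAtLeast-⋆₀ = AllWords-⋆₀
    (λ {u} {v} a≤u b≤v → weightAtLeast-mono (ℕP.+-mono-≤ a≤u b≤v) (quasiShuffle-weight u v))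

  weightAtLeast-∘₀ : ∀ {a b p q} → WeightAtLeast a p → WeightAtLeast b q → WeightAtLeast (a ℕ.+ b) (p ∘₀ q)
  weightAtLeast-∘₀ {a} {b} hp hq = AllWords-⊖ (AllWords-⊖ (weightAtLeast-⋆₀ hp hq) (weightAtLeast-· hp hq))
    (weightAtLeast-mono (ℕP.≤-reflexive (ℕP.+-comm a b)) (weightAtLeast-· hq hp))

  weightAtLeast-letters : ∀ {p} → Letters p → WeightAtLeast 1 p
  weightAtLeast-letters = All.map (λ { (y e i , refl) → s≤s z≤n })

  weightAtLeast-starPow₀ : ∀ {z} → WeightAtLeast 1 z → ∀ k → WeightAtLeast k (starPow₀ z k)
  weightAtLeast-starPow₀ hz zero = weightAtLeast-0 𝟙
  weightAtLeast-starPow₀ hz (suc k) = weightAtLeast-⋆₀ hz (weightAtLeast-starPow₀ hz k)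

  weightAtLeast-δ₀^ : ∀ {z} → WeightAtLeast 1 z → ∀ k w → WeightAtLeast k (δ₀^ k z w)
  weightAtLeast-δ₀^ hz zero w = weightAtLeast-0 w
  weightAtLeast-δ₀^ hz (suc k) w =
    AllWords-⊖ (weightAtLeast-⋆₀ hz (weightAtLeast-δ₀^ hz k w)) (weightAtLeast-· hz (weightAtLeast-δ₀^ hz k w))

  weightAtLeast-circPowS₀ : ∀ {z} → WeightAtLeast 1 z → ∀ k → WeightAtLeast (suc k) (circPowS₀ z k)
  weightAtLeast-circPowS₀ hz zero = hz
  weightAtLeast-circPowS₀ hz (suc k) = weightAtLeast-∘₀ hz (weightAtLeast-circPowS₀ hz k)

  weightAtLeast-catPow : ∀ {p} → WeightAtLeast 1 p → ∀ k → WeightAtLeast k (catPow p k)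
  weightAtLeast-catPow hp zero = weightAtLeast-0 𝟙
  weightAtLeast-catPow hp (suc k) = weightAtLeast-· hp (weightAtLeast-catPow hp k)

  infix 4 _≈[≤_]_
  record _≈[≤_]_ (p : Poly) (m : ℕ) (q : Poly) : Set where
    constructor upTo
    field
      remainder : Poly
      remainder-heavy : WeightAtLeast (suc m) remainder
      ≈-remainder : p ≈ q ⊕ remainder

  ≈⇒≈[≤] : ∀ {m p q} → p ≈ q → p ≈[≤ m ] q
  ≈⇒≈[≤] {q = q} p≈q = upTo 0P [] (≈-trans p≈q (≡⇒≈ (sym (ListP.++-identityʳ q))))

  ≈[≤]-sym : ∀ {m p q} → p ≈[≤ m ] q → q ≈[≤ m ] p
  ≈[≤]-sym {p = p} {q} (upTo r hr e) = upTo (scale (- 1ℚ) r) (AllWords-scale (- 1ℚ) hr) (begin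
      q                      ≡⟨ ListP.++-identityʳ q ⟨
      q ⊕ 0P                 ≈⟨ ⊕-congˡ q (⊖-cancel r) ⟨
      q ⊕ (r ⊖ r)            ≡⟨ ListP.++-assoc q r _ ⟨
      (q ⊕ r) ⊖ r            ≈⟨ ⊕-congʳ (scale (- 1ℚ) r) e ⟨
      p ⊖ r                  ∎)
    where open ≈-Reasoning

  ≈[≤]-trans : ∀ {m p q s} → p ≈[≤ m ] q → q ≈[≤ m ] s → p ≈[≤ m ] s
  ≈[≤]-trans {s = s} (upTo r hr e) (upTo r′ hr′ e′) =
    upTo (r′ ⊕ r) (AllWords-⊕ hr′ hr) (≈-trans e (≈-trans (⊕-congʳ r e′) (≡⇒≈ (ListP.++-assoc s r′ r))))

  ≈[≤]-setoid : ℕ → Setoid _ _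
  ≈[≤]-setoid m = record { Carrier = Poly ; _≈_ = _≈[≤ m ]_
    ; isEquivalence = record { refl = ≈⇒≈[≤] ≈-refl ; sym = ≈[≤]-sym ; trans = ≈[≤]-trans } }


  module ≈[≤]-Reasoning (m : ℕ) = SetoidReasoning (≈[≤]-setoid m)

  heavy≈[≤]0 : ∀ {m p} → WeightAtLeast (suc m) p → p ≈[≤ m ] 0P
  heavy≈[≤]0 {p = p} hp = upTo p hp ≈-refl

  ≈[≤]-coeff : ∀ {m p q} → p ≈[≤ m ] q → ∀ u → wt u ≤ m → coeff p u ≡ coeff q u
  ≈[≤]-coeff {p = p} {q} (upTo r hr e) u wt-u≤m = begin
    coeff p u              ≡⟨ coeff-≡ e u ⟩
    coeff (q ⊕ r) u        ≡⟨ coeff-⊕ q r u ⟩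
    coeff q u + coeff r u  ≡⟨ cong (coeff q u +_) (coeff-weightAtLeast hr u wt-u≤m) ⟩
    coeff q u + 0ℚ         ≡⟨ ℚP.+-identityʳ _ ⟩
    coeff q u              ∎
    where open ≡-Reasoning

  ≈[≤]-mono : ∀ {m m′ p q} → m′ ≤ m → p ≈[≤ m ] q → p ≈[≤ m′ ] q
  ≈[≤]-mono m′≤m (upTo r hr e) = upTo r (weightAtLeast-mono (s≤s m′≤m) hr) e

  ≈[≤]-⊕ : ∀ {m p p′ q q′} → p ≈[≤ m ] p′ → q ≈[≤ m ] q′ → p ⊕ q ≈[≤ m ] p′ ⊕ q′
  ≈[≤]-⊕ {p′ = p′} {q′ = q′} (upTo r hr e) (upTo s hs f) =
    upTo (r ⊕ s) (AllWords-⊕ hr hs) (≈-trans (⊕-cong e f) (⊕-interchange p′ r q′ s))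

  ≈[≤]-⊕ˡ : ∀ {m q q′} p → q ≈[≤ m ] q′ → p ⊕ q ≈[≤ m ] p ⊕ q′
  ≈[≤]-⊕ˡ p = ≈[≤]-⊕ (≈⇒≈[≤] (≈-refl {p}))

  ≈[≤]-·ˡ : ∀ {m q q′} p → q ≈[≤ m ] q′ → p · q ≈[≤ m ] p · q′
  ≈[≤]-·ˡ {q′ = q′} p (upTo r hr e) = upTo (p · r) (weightAtLeast-· (weightAtLeast-0 p) hr)
    (≈-trans (·-congˡ p e) (IsLinear.⊕-homo (·-linearʳ p) q′ r))

  ≈[≤]-·ʳ : ∀ {m p p′} q → p ≈[≤ m ] p′ → p · q ≈[≤ m ] p′ · q
  ≈[≤]-·ʳ {m} {p′ = p′} q (upTo r hr e) =
    upTo (r · q) (weightAtLeast-mono (ℕP.≤-reflexive (sym (ℕP.+-identityʳ (suc m)))) (weightAtLeast-· hr (weightAtLeast-0 q)))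
      (≈-trans (·-congʳ q e) (IsLinear.⊕-homo (·-linearˡ q) p′ r))

  Σ≤-cong : ∀ m {f g} → (∀ k → f k ≈ g k) → Σ≤ m f ≈ Σ≤ m g
  Σ≤-cong zero h = h 0
  Σ≤-cong (suc m) h = ⊕-cong (Σ≤-cong m h) (h (suc m))

  Σ≤-linear : ∀ {L} → IsLinear L → ∀ m f → L (Σ≤ m f) ≈ Σ≤ m (λ k → L (f k))
  Σ≤-linear L zero f = ≈-refl
  Σ≤-linear L (suc m) f = ≈-trans (IsLinear.⊕-homo L (Σ≤ m f) (f (suc m))) (⊕-congʳ _ (Σ≤-linear L m f))

  Σ≤-⊕ : ∀ m f g → Σ≤ m (λ k → f k ⊕ g k) ≈ Σ≤ m f ⊕ Σ≤ m g
  Σ≤-⊕ zero f g = ≈-refl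
  Σ≤-⊕ (suc m) f g = ≈-trans (⊕-congʳ (f (suc m) ⊕ g (suc m)) (Σ≤-⊕ m f g))
    (⊕-interchange (Σ≤ m f) (Σ≤ m g) (f (suc m)) (g (suc m)))

  Σ≤-suc : ∀ m f → Σ≤ (suc m) f ≈ f 0 ⊕ Σ≤ m (λ k → f (suc k))
  Σ≤-suc zero f = ≈-refl
  Σ≤-suc (suc m) f = ≈-trans (⊕-congʳ (f (suc (suc m))) (Σ≤-suc m f)) (≡⇒≈ (ListP.++-assoc (f 0) _ _))

  Σ≤-· : ∀ M m A B → Σ≤ M A · Σ≤ m B ≈ Σ≤ M (λ a → Σ≤ m (λ b → A a · B b))
  Σ≤-· M m A B = ≈-trans (Σ≤-linear (·-linearˡ (Σ≤ m B)) M A) (Σ≤-cong M (λ a → Σ≤-linear (·-linearʳ (A a)) m B))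

  Σ≤-heavy-tail : ∀ M {c} g → (∀ a → WeightAtLeast (suc c) (g (suc a))) → Σ≤ M g ≈[≤ c ] g 0
  Σ≤-heavy-tail zero g h = ≈⇒≈[≤] ≈-refl
  Σ≤-heavy-tail (suc M) {c} g h = begin
    Σ≤ (suc M) g                      ≈⟨ ≈⇒≈[≤] (Σ≤-suc M g) ⟩
    g 0 ⊕ Σ≤ M (λ k → g (suc k))      ≈⟨ ≈[≤]-⊕ˡ (g 0) (heavy≈[≤]0 (AllWords-Σ≤ M h)) ⟩
    g 0 ⊕ 0P                          ≈⟨ ≈⇒≈[≤] (≡⇒≈ (ListP.++-identityʳ (g 0))) ⟩
    g 0                               ∎
    where open ≈[≤]-Reasoning c

  triangle-split : ∀ m F → Σ≤ (suc m) (diag F) ≈ Σ≤ (suc m) (F 0) ⊕ Σ≤ m (diag (λ a b → F (suc a) b))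
  triangle-split zero F = ≡⇒≈ (sym (ListP.++-assoc (F 0 0) (F 0 1) (F 1 0)))
  triangle-split (suc m) F = ≈-trans (⊕-congʳ (diag F (suc (suc m))) (triangle-split m F))
    (⊕-interchange (Σ≤ (suc m) (F 0)) _ (F 0 (suc (suc m))) _)

  -- The terms of the rectangle outside the triangle a + b ≤ m have weight > m.
  rectangle≈[≤]triangle : ∀ m c F → (∀ a b → WeightAtLeast (a ℕ.+ b ℕ.+ c) (F a b)) → ∀ M → m ≤ M →
    Σ≤ M (λ a → Σ≤ m (F a)) ≈[≤ m ℕ.+ c ] Σ≤ m (diag F)
  rectangle≈[≤]triangle zero c F h M _ =
    Σ≤-heavy-tail M (λ a → F a 0) (λ a → weightAtLeast-mono (s≤s (ℕP.m≤n+m c (a ℕ.+ 0))) (h (suc a) 0))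
  rectangle≈[≤]triangle (suc m) c F h (suc M) (s≤s m≤M) = begin
      Σ≤ (suc M) (λ a → Σ≤ (suc m) (F a))
    ≈⟨ ≈⇒≈[≤] (Σ≤-suc M (λ a → Σ≤ (suc m) (F a))) ⟩
      Σ≤ (suc m) (F 0) ⊕ Σ≤ M (λ a → Σ≤ m (F′ a) ⊕ F′ a (suc m))
    ≈⟨ ≈[≤]-⊕ˡ (Σ≤ (suc m) (F 0)) (≈⇒≈[≤] (Σ≤-⊕ M (λ a → Σ≤ m (F′ a)) (λ a → F′ a (suc m)))) ⟩
      Σ≤ (suc m) (F 0) ⊕ (Σ≤ M (λ a → Σ≤ m (F′ a)) ⊕ Σ≤ M (λ a → F′ a (suc m)))
    ≈⟨ ≈[≤]-⊕ˡ (Σ≤ (suc m) (F 0)) (≈[≤]-⊕ inner (heavy≈[≤]0 (AllWords-Σ≤ M outer-heavy))) ⟩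
      Σ≤ (suc m) (F 0) ⊕ (Σ≤ m (diag F′) ⊕ 0P)
    ≈⟨ ≈⇒≈[≤] (⊕-congˡ (Σ≤ (suc m) (F 0)) (≡⇒≈ (ListP.++-identityʳ _))) ⟩
      Σ≤ (suc m) (F 0) ⊕ Σ≤ m (diag F′)
    ≈⟨ ≈⇒≈[≤] (triangle-split m F) ⟨
      Σ≤ (suc m) (diag F)
    ∎
    where
      open ≈[≤]-Reasoning (suc m ℕ.+ c)
      F′ : ℕ → ℕ → Poly
      F′ a b = F (suc a) b
      inner : Σ≤ M (λ a → Σ≤ m (F′ a)) ≈[≤ suc m ℕ.+ c ] Σ≤ m (diag F′)
      inner = ≈[≤]-mono (ℕP.≤-reflexive (sym (ℕP.+-suc m c)))
        (rectangle≈[≤]triangle m (suc c) F′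
          (λ a b → weightAtLeast-mono (ℕP.≤-reflexive (ℕP.+-suc (a ℕ.+ b) c)) (h (suc a) b)) M m≤M)
      outer-heavy : ∀ a → WeightAtLeast (suc (suc m ℕ.+ c)) (F′ a (suc m))
      outer-heavy a = weightAtLeast-mono (s≤s (ℕP.+-monoˡ-≤ c (ℕP.m≤n+m (suc m) a))) (h (suc a) (suc m))

  Σ≤-tail : ℕ → (ℕ → Poly) → Poly
  Σ≤-tail zero f = 0P
  Σ≤-tail (suc m) f = Σ≤ m (λ k → f (suc k))

  Σ≤-head-tail : ∀ m f → Σ≤ m f ≈ f 0 ⊕ Σ≤-tail m f
  Σ≤-head-tail zero f = ≡⇒≈ (sym (ListP.++-identityʳ (f 0)))
  Σ≤-head-tail (suc m) f = Σ≤-suc m f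

  telescope : ∀ m (f : ℕ → Poly) → Σ≤ m (λ k → f k ⊖ f (suc k)) ≈ f 0 ⊖ f (suc m)
  telescope zero f = ≈-refl
  telescope (suc m) f = ≈-trans (⊕-congʳ (f (suc m) ⊖ f (suc (suc m))) (telescope m f))
    (⊖-⊕-⊖ (f 0) (f (suc m)) (f (suc (suc m))))

  catPow-cong : ∀ {p q} → p ≈ q → ∀ k → catPow p k ≈ catPow q k
  catPow-cong e zero = ≈-refl
  catPow-cong e (suc k) = ·-cong e (catPow-cong e k)

  catPow-·-comm : ∀ p k → catPow p k · p ≈ p · catPow p k
  catPow-·-comm p zero = ≈-trans (·-identityˡ p) (≈-sym (·-identityʳ p))
  catPow-·-comm p (suc k) = ≈-trans (·-assoc p (catPow p k) p) (·-congˡ p (catPow-·-comm p k))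

  catPow-·-⊖ : ∀ d k → catPow d k · (𝟙 ⊖ d) ≈ catPow d k ⊖ catPow d (suc k)
  catPow-·-⊖ d k = begin
    catPow d k · (𝟙 ⊖ d)               ≈⟨ IsLinear.⊖-homo (·-linearʳ (catPow d k)) 𝟙 d ⟩
    catPow d k · 𝟙 ⊖ catPow d k · d    ≈⟨ ⊕-cong (·-identityʳ (catPow d k)) (scale-cong (- 1ℚ) (catPow-·-comm d k)) ⟩
    catPow d k ⊖ catPow d (suc k)      ∎
    where open ≈-Reasoning

  -- With d = 𝟙 − e, the partial sums Σ_{k ≤ m} d^k invert e up to d^(m+1), whose words
  -- have weight > m since d has no constant term.
  invCat-· : ∀ m {e p} → e ≈ 𝟙 ⊕ p → WeightAtLeast 1 p → invCat m e · e ≈[≤ m ] 𝟙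
  invCat-· m {e} {p} e≈𝟙⊕p p-heavy = begin
      invCat m e · e
    ≈⟨ ≈⇒≈[≤] (Σ≤-linear (·-linearˡ e) m (catPow d)) ⟩
      Σ≤ m (λ k → catPow d k · e)
    ≈⟨ ≈⇒≈[≤] (Σ≤-cong m geometric-step) ⟩
      Σ≤ m (λ k → catPow d k ⊖ catPow d (suc k))
    ≈⟨ ≈⇒≈[≤] (telescope m (catPow d)) ⟩
      𝟙 ⊖ catPow d (suc m)
    ≈⟨ ≈⇒≈[≤] (⊕-congˡ 𝟙 (scale-cong (- 1ℚ) (catPow-cong d≈-p (suc m)))) ⟩
      𝟙 ⊖ catPow (scale (- 1ℚ) p) (suc m)
    ≈⟨ ≈[≤]-⊕ˡ 𝟙 (heavy≈[≤]0 (AllWords-scale (- 1ℚ)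
         (weightAtLeast-catPow (AllWords-scale (- 1ℚ) p-heavy) (suc m)))) ⟩
      𝟙 ⊕ 0P
    ≈⟨ ≈⇒≈[≤] ≈-refl ⟩
      𝟙
    ∎
    where
      open ≈[≤]-Reasoning m
      d = 𝟙 ⊖ e
      d≈-p : d ≈ scale (- 1ℚ) p
      d≈-p = ≈-trans (⊕-congˡ 𝟙 (scale-cong (- 1ℚ) e≈𝟙⊕p)) (⊖-⊕ 𝟙 p)
      geometric-step : ∀ k → catPow d k · e ≈ catPow d k ⊖ catPow d (suc k)
      geometric-step k = ≈-trans (·-congˡ (catPow d k) (≈-sym (⊖-⊖ 𝟙 e))) (catPow-·-⊖ d k)

  -- The exponential identities

  expδ₀≈[≤]exp∘∘₀·exp⋆₀ : ∀ {z z′} → Letters z → Letters z′ →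
    ∀ m → expδ₀ m z z′ ≈[≤ m ] exp∘∘₀ m z z′ · exp⋆₀ m z
  expδ₀≈[≤]exp∘∘₀·exp⋆₀ {z} {z′} hz hz′ m = begin
      Σ≤ m (λ k → scale (invFact k) (δ₀^ k z z′))
    ≈⟨ ≈⇒≈[≤] (Σ≤-cong m (iterate≈diag-product (δ₀-linearʳ z) (∘₀-linearʳ z) (⋆₀-linearʳ z) (δ₀-· hz)
         α (starPow₀ z) (λ k → δ₀^ k z z′) α-shift (λ _ → ≈-refl) (≈-sym (·-identityʳ z′)) (λ _ → ≈-refl))) ⟩
      Σ≤ m (diag F)
    ≈⟨ ≈[≤]-mono (ℕP.≤-reflexive (sym (ℕP.+-identityʳ m)))
         (rectangle≈[≤]triangle m 0 F F-heavy (suc m) (ℕP.n≤1+n m)) ⟨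
      Σ≤ (suc m) (λ a → Σ≤ m (F a))
    ≈⟨ ≈⇒≈[≤] (Σ≤-· (suc m) m (expTerm α) (expTerm (starPow₀ z))) ⟨
      Σ≤ (suc m) (expTerm α) · exp⋆₀ m z
    ≈⟨ ≈⇒≈[≤] (·-congʳ (exp⋆₀ m z) (≈-trans (Σ≤-suc m (expTerm α)) (⊕-congʳ _ (scale-1 z′)))) ⟩
      exp∘∘₀ m z z′ · exp⋆₀ m z
    ∎
    where
      open ≈[≤]-Reasoning m
      α : ℕ → Poly
      α zero = z′
      α (suc a) = circPowS₀ z a ∘₀ z′
      α-shift : ∀ a → z ∘₀ α a ≈ α (suc a)
      α-shift zero = ≈-refl
      α-shift (suc a) = ≈-sym (circPowS₀-suc-∘₀ hz hz′ a)
      F : ℕ → ℕ → Poly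
      F a b = expTerm α a · expTerm (starPow₀ z) b
      z-heavy = weightAtLeast-letters hz
      α-heavy : ∀ a → WeightAtLeast a (α a)
      α-heavy zero = weightAtLeast-0 z′
      α-heavy (suc a) = weightAtLeast-mono (ℕP.m≤m+n (suc a) 1)
        (weightAtLeast-∘₀ (weightAtLeast-circPowS₀ z-heavy a) (weightAtLeast-letters hz′))
      F-heavy : ∀ a b → WeightAtLeast (a ℕ.+ b ℕ.+ 0) (F a b)
      F-heavy a b = weightAtLeast-mono (ℕP.≤-reflexive (ℕP.+-identityʳ (a ℕ.+ b)))
        (weightAtLeast-· (AllWords-scale (invFact a) (α-heavy a)) (AllWords-scale (invFact b) (weightAtLeast-starPow₀ z-heavy b)))

  exp⋆₀⋆₀≈[≤]exp⋆₀·expδ₀ : ∀ {z} → Letters z →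
    ∀ m w → exp⋆₀ m z ⋆₀ w ≈[≤ m ] exp⋆₀ m z · expδ₀ m z w
  exp⋆₀⋆₀≈[≤]exp⋆₀·expδ₀ {z} hz m w = begin
      Σ≤ m (expTerm (starPow₀ z)) ⋆₀ w
    ≈⟨ ≈⇒≈[≤] (≈-trans (Σ≤-linear (⋆₀-linearˡ w) m (expTerm (starPow₀ z)))
         (Σ≤-cong m (λ k → IsLinear.scale-homo (⋆₀-linearˡ w) (invFact k) (starPow₀ z k)))) ⟩
      Σ≤ m (λ k → scale (invFact k) (starPow₀ z k ⋆₀ w))
    ≈⟨ ≈⇒≈[≤] (Σ≤-cong m (iterate≈diag-product (⋆₀-linearʳ z) (⋆₀-linearʳ z) (δ₀-linearʳ z) (⋆₀-· hz)
         (starPow₀ z) (λ k → δ₀^ k z w) (λ k → starPow₀ z k ⋆₀ w) (λ _ → ≈-refl) (λ _ → ≈-refl)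
         (≈-trans (⋆₀-identityˡ w) (≈-sym (·-identityˡ w))) (λ k → ⋆₀-assoc z (starPow₀ z k) w))) ⟩
      Σ≤ m (diag F)
    ≈⟨ ≈[≤]-mono (ℕP.≤-reflexive (sym (ℕP.+-identityʳ m))) (rectangle≈[≤]triangle m 0 F F-heavy m ℕP.≤-refl) ⟨
      Σ≤ m (λ a → Σ≤ m (F a))
    ≈⟨ ≈⇒≈[≤] (Σ≤-· m m (expTerm (starPow₀ z)) (expTerm (λ k → δ₀^ k z w))) ⟨
      exp⋆₀ m z · expδ₀ m z w
    ∎
    where
      open ≈[≤]-Reasoning m
      z-heavy = weightAtLeast-letters hz
      F : ℕ → ℕ → Poly
      F a b = expTerm (starPow₀ z) a · expTerm (λ k → δ₀^ k z w) b
      F-heavy : ∀ a b → WeightAtLeast (a ℕ.+ b ℕ.+ 0) (F a b)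
      F-heavy a b = weightAtLeast-mono (ℕP.≤-reflexive (ℕP.+-identityʳ (a ℕ.+ b)))
        (weightAtLeast-· (AllWords-scale (invFact a) (weightAtLeast-starPow₀ z-heavy a))
                         (AllWords-scale (invFact b) (weightAtLeast-δ₀^ z-heavy b w)))

  expδ₀≈[≤]invCat : ∀ {z} → Letters z →
    ∀ m w → expδ₀ m z w ≈[≤ m ] invCat m (exp⋆₀ m z) · (exp⋆₀ m z ⋆₀ w)
  expδ₀≈[≤]invCat {z} hz m w = begin
      X                 ≈⟨ ≈⇒≈[≤] (·-identityˡ X) ⟨
      𝟙 · X             ≈⟨ ≈[≤]-·ʳ X (invCat-· m (Σ≤-head-tail m (expTerm (starPow₀ z))) (tail-heavy m)) ⟨
      (I · E) · X       ≈⟨ ≈⇒≈[≤] (·-assoc I E X) ⟩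
      I · (E · X)       ≈⟨ ≈[≤]-·ˡ I (exp⋆₀⋆₀≈[≤]exp⋆₀·expδ₀ hz m w) ⟨
      I · (E ⋆₀ w)      ∎
    where
      open ≈[≤]-Reasoning m
      E = exp⋆₀ m z
      I = invCat m E
      X = expδ₀ m z w
      tail-heavy : ∀ m → WeightAtLeast 1 (Σ≤-tail m (expTerm (starPow₀ z)))
      tail-heavy zero = []
      tail-heavy (suc m) = AllWords-Σ≤ m (λ k → AllWords-scale (invFact (suc k))
        (weightAtLeast-mono (s≤s z≤n) (weightAtLeast-starPow₀ (weightAtLeast-letters hz) (suc k))))

  coeff-toAbsoluteP-≈[≤] : ∀ {m p q} → p ≈[≤ m ] q →
    ∀ u → wt u ≤ m → coeff (toAbsoluteP p) u ≡ coeff (toAbsoluteP q) u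
  coeff-toAbsoluteP-≈[≤] {m} {p} {q} p≈q u wt-u≤m = begin
    coeff (toAbsoluteP p) u    ≡⟨ coeff-toAbsoluteP p u ⟩
    coeff p (toRelative u)     ≡⟨ ≈[≤]-coeff p≈q (toRelative u) (subst (_≤ m) (sym (wt-toRelativeFrom Fin.zero u)) wt-u≤m) ⟩
    coeff q (toRelative u)     ≡⟨ coeff-toAbsoluteP q u ⟨
    coeff (toAbsoluteP q) u    ∎
    where open ≡-Reasoning

  coeff-expδ-𝔷 : ∀ {z z′} → IndexZeroP z → Letters z → IndexZeroP z′ → Letters z′ → ∀ m u → wt u ≤ m →
    coeff (expδ m z z′) u ≡ coeff (exp∘∘ m z z′ · exp⋆ m z) u
  coeff-expδ-𝔷 {z} {z′} iz lz iz′ lz′ m u wt-u≤m = begin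
      coeff (expδ m z z′) u
    ≡⟨ cong (λ t → coeff (expδ m z t) u) (toAbsoluteP-indexZero iz′) ⟨
      coeff (expδ m z (toAbsoluteP z′)) u
    ≡⟨ cong (λ t → coeff t u) (expδ-toAbsoluteP m z′ iz) ⟩
      coeff (toAbsoluteP (expδ₀ m z z′)) u
    ≡⟨ coeff-toAbsoluteP-≈[≤] (expδ₀≈[≤]exp∘∘₀·exp⋆₀ lz lz′ m) u wt-u≤m ⟩
      coeff (toAbsoluteP (exp∘∘₀ m z z′ · exp⋆₀ m z)) u
    ≡⟨ cong (λ t → coeff t u)
         (toAbsoluteP-indexZero (indexZero-· (indexZero-exp∘∘₀ m iz iz′) (indexZero-exp⋆₀ m iz))) ⟩
      coeff (exp∘∘₀ m z z′ · exp⋆₀ m z) u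
    ≡⟨ cong₂ (λ a b → coeff (a · b) u) (exp∘∘≡exp∘∘₀ m iz iz′) (exp⋆≡exp⋆₀ m iz) ⟨
      coeff (exp∘∘ m z z′ · exp⋆ m z) u
    ∎
    where open ≡-Reasoning

  coeff-expδ : ∀ {z} → IndexZeroP z → Letters z → ∀ w m u → wt u ≤ m →
    coeff (expδ m z w) u ≡ coeff (invCat m (exp⋆ m z) · (exp⋆ m z ⋆ w)) u
  coeff-expδ {z} iz lz w m u wt-u≤m = begin
      coeff (expδ m z w) u
    ≡⟨ cong (λ t → coeff (expδ m z t) u) (toAbsoluteP-toRelativeP w) ⟨
      coeff (expδ m z (toAbsoluteP w₀)) u
    ≡⟨ cong (λ t → coeff t u) (expδ-toAbsoluteP m w₀ iz) ⟩
      coeff (toAbsoluteP (expδ₀ m z w₀)) u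
    ≡⟨ coeff-toAbsoluteP-≈[≤] (expδ₀≈[≤]invCat lz m w₀) u wt-u≤m ⟩
      coeff (toAbsoluteP (I · (E ⋆₀ w₀))) u
    ≡⟨ cong (λ t → coeff t u) (·-toAbsoluteP (E ⋆₀ w₀) (indexZero-invCat m (indexZero-exp⋆₀ m iz))) ⟨
      coeff (I · toAbsoluteP (E ⋆₀ w₀)) u
    ≡⟨ cong (λ t → coeff (I · t) u) (toAbsoluteP-⋆₀ E w₀) ⟨
      coeff (I · (toAbsoluteP E ⋆ toAbsoluteP w₀)) u
    ≡⟨ cong₂ (λ a b → coeff (I · (a ⋆ b)) u) (toAbsoluteP-indexZero (indexZero-exp⋆₀ m iz)) (toAbsoluteP-toRelativeP w) ⟩
      coeff (I · (E ⋆ w)) u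
    ≡⟨ cong (λ e → coeff (invCat m e · (e ⋆ w)) u) (exp⋆≡exp⋆₀ m iz) ⟨
      coeff (invCat m (exp⋆ m z) · (exp⋆ m z ⋆ w)) u
    ∎
    where
      open ≡-Reasoning
      w₀ = toRelativeP w
      E = exp⋆₀ m z
      I = invCat m E

mainTheorem11 : (n : ℕ) → (z z' : Stuffle.Zelt n) → (w : Stuffle.Poly n) → (u : Stuffle.Word n) →
                  (Stuffle.expδS n z (Stuffle.toP n z') u ≡ Stuffle.rhs₁ n z z' u)
                  × (Stuffle.expδS n z w u ≡ Stuffle.rhs₂ n z w u)
mainTheorem11 n z z' w u =
    coeff-expδ-𝔷 n (indexZero-toP n z) (letters-toP n z) (indexZero-toP n z') (letters-toP n z') (wt u) u ℕP.≤-refl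
  , coeff-expδ n (indexZero-toP n z) (letters-toP n z) w (wt u) u ℕP.≤-refl
  where open Stuffle n using (wt)
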